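{- Let $M$ be a matroid on a ground set $E\neq\emptyset$. If the dimension of $Q(M)$ is less than $|E|-1$, then $F(M)$ lies in $\mathfrak{m}^2$; that is, the image of $F(M)$ in $\mathcal{QS}ym/\mathfrak{m}^2$ is zero.
   Context: For a matroid $M$ on finite ground set $E$ with bases $\mathcal{B}(M)$ and $f:E\to\mathbb{P}=\{1,2,\ldots\}$, $f$ is $M$-generic if the minimum of $f(B)=\sum_{e\in B}f(e)$ over bases is attained by a unique base; $F(M)=\sum_{f\ M\text{ -generic}}\prod_{e\in E}x_{f(e)}$, a quasisymmetric function. $Q(M)=\mathrm{conv}\{\sum_{i\in B}e_i:B\in\mathcal{B}(M)\}\subset\mathbb{R}^E$ is the matroid base polytope. $\mathcal{QS}ym$ denotes the graded $\mathbb{Z}$-algebra of quasisymmetric functions in $x_1,x_2,\ldots$ with integer coefficients, and $\mathfrak{m}=\bigoplus_{d\ge1}\mathcal{QS}ym_d$ its maximal homogeneous ideal. -}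

module Defs where

open import Data.Bool using (Bool; true; false; _∧_; if_then_else_)
import Data.Bool
open import Data.Nat using (ℕ; zero; suc; _+_; _≤ᵇ_; _≡ᵇ_; _<_)
open import Data.Integer as ℤ using (ℤ)
open import Data.Fin using (Fin; toℕ)
open import Data.Fin.Subset using (Subset; _∈_; _∉_; inside; outside)
open import Data.Vec using (Vec; []; _∷_; lookup; _[_]≔_)
open import Data.List as L using (List; []; _∷_; length; filter; map)
open import Data.List.Relation.Unary.All using (All)
open import Data.Product using (Σ; ∃; _×_; _,_)
open import Relation.Binary.PropositionalEquality using (_≡_)
open import Relation.Nullary using (¬_)

sumFinℕ : ∀ {k} → (Fin k → ℕ) → ℕ
sumFinℕ {zero}  a = 0
sumFinℕ {suc k} a = a Data.Fin.zero + sumFinℕ {k} (λ i → a (Data.Fin.suc i))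

sumFinℤ : ∀ {k} → (Fin k → ℤ) → ℤ
sumFinℤ {zero}  a = ℤ.+ 0
sumFinℤ {suc k} a = a Data.Fin.zero ℤ.+ sumFinℤ {k} (λ i → a (Data.Fin.suc i))

sumListℤ : List ℤ → ℤ
sumListℤ = L.foldr ℤ._+_ (ℤ.+ 0)

allFinL : (k : ℕ) → List (Fin k)
allFinL zero    = []
allFinL (suc k) = Data.Fin.zero ∷ map Data.Fin.suc (allFinL k)

allSubsets : (n : ℕ) → List (Subset n)
allSubsets zero    = [] ∷ []
allSubsets (suc n) =
  map (outside ∷_) (allSubsets n) L.++ map (inside ∷_) (allSubsets n)

allFuns : (n k : ℕ) → List (Vec (Fin k) n)
allFuns zero    k = [] ∷ []
allFuns (suc n) k =
  L.concatMap (λ v → map (_∷ v) (allFinL k)) (allFuns n k)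

-- Matroids on the ground set E = Fin n, given by their bases

record Matroid (n : ℕ) : Set where
  field
    isBase   : Subset n → Bool
    nonempty : ∃ λ B → isBase B ≡ true
    exchange : ∀ B₁ B₂ → isBase B₁ ≡ true → isBase B₂ ≡ true →
               ∀ x → x ∈ B₁ → x ∉ B₂ →
               ∃ λ y → y ∈ B₂ × y ∉ B₁ ×
                 isBase ((B₁ [ x ]≔ outside) [ y ]≔ inside) ≡ true
open Matroid public

bases : ∀ {n} → Matroid n → List (Subset n)
bases {n} M = filter (λ B → isBase M B Data.Bool.≟ true) (allSubsets n)

weight : ∀ {n} → (Fin n → ℕ) → Subset n → ℕ
weight f B = sumFinℕ (λ e → if lookup B e then f e else 0)

allᵇ : ∀ {A : Set} → (A → Bool) → List A → Bool
allᵇ p = L.foldr (λ x b → p x ∧ b) true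

countᵇ : ∀ {A : Set} → (A → Bool) → List A → ℕ
countᵇ p []       = 0
countᵇ p (x ∷ xs) = (if p x then 1 else 0) + countᵇ p xs

isGeneric : ∀ {n} → Matroid n → (Fin n → ℕ) → Bool
isGeneric M f =
  countᵇ (λ B → allᵇ (λ B' → weight f B ≤ᵇ weight f B') (bases M)) (bases M)
    ≡ᵇ 1

-- Formal power series in x₁, x₂, … with ℤ coefficients, represented by
-- their coefficient functions.  A monomial x₁^{β₀} x₂^{β₁} … x_k^{β_{k-1}}
-- is the exponent list β = (β₀, …, β_{k-1}) (trailing zeros allowed).

Series : Set
Series = List ℕ → ℤ

listEqᵇ : List ℕ → List ℕ → Bool
listEqᵇ []       []       = true
listEqᵇ (a ∷ as) (b ∷ bs) = (a ≡ᵇ b) ∧ listEqᵇ as bs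
listEqᵇ _        _        = false

-- exponent vector of the monomial Π_e x_{f(e)} for f : E → {1,…,k}
-- (value j : Fin k stands for the variable x_{j+1})
expVec : ∀ {n k} → Vec (Fin k) n → List ℕ
expVec {n} {k} v =
  map (λ j → countᵇ (λ e → toℕ (lookup v e) ≡ᵇ toℕ j) (allFinL n)) (allFinL k)

-- F(M) = Σ_{f M-generic} Π_e x_{f(e)} ; coefficient of x^β is the number of
-- M-generic f : E → {1,…,length β} whose monomial is x^β.
FM : ∀ {n} → Matroid n → Series
FM {n} M β = ℤ.+ countᵇ
  (λ v → isGeneric M (λ e → suc (toℕ (lookup v e))) ∧ listEqᵇ (expVec v) β)
  (allFuns n (length β))

-- product of series: (g h)_β = Σ_{γ + δ = β} g_γ h_δ
mul : Series → Series → Series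
mul g h []       = g [] ℤ.* h []
mul g h (b ∷ β)  = sumFinℤ {suc b} (λ c →
  mul (λ γ → g (toℕ c ∷ γ)) (λ δ → h ((b Data.Nat.∸ toℕ c) ∷ δ)) β)

compress : List ℕ → List ℕ
compress []            = []
compress (zero  ∷ β)   = compress β
compress (suc a ∷ β)   = suc a ∷ compress β

expSum : List ℕ → ℕ
expSum = L.foldr _+_ 0

record QSym : Set where
  field
    coeff     : Series
    -- quasisymmetry: coeff of x_{i₁}^{a₁}⋯x_{i_k}^{a_k} (i₁<⋯<i_k) equals
    -- coeff of x₁^{a₁}⋯x_k^{a_k}
    quasisym  : ∀ β → coeff β ≡ coeff (compress β)
    -- bounded degree (finite sum of homogeneous components)
    boundedDeg : ∃ λ D → ∀ β → D < expSum β → coeff β ≡ ℤ.+ 0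
open QSym public

-- g ∈ 𝔪 = ⊕_{d ≥ 1} QSym_d : no constant term
inMaxIdeal : QSym → Set
inMaxIdeal g = coeff g [] ≡ ℤ.+ 0

InMaxIdealSq : Series → Set
InMaxIdealSq G = ∃ λ (ps : List (QSym × QSym)) →
  All (λ p → inMaxIdeal (Data.Product.proj₁ p) × inMaxIdeal (Data.Product.proj₂ p)) ps ×
  (∀ β → G β ≡ sumListℤ (map (λ p → mul (coeff (Data.Product.proj₁ p)) (coeff (Data.Product.proj₂ p)) β) ps))

-- Dimension of the base polytope Q(M) = conv{ 1_B : B base } ⊂ ℝ^E

indicator : ∀ {n} → Subset n → Fin n → ℤ
indicator B e = if lookup B e then ℤ.+ 1 else ℤ.+ 0

AffinelyIndependent : ∀ {n d} → (Fin (suc d) → (Fin n → ℤ)) → Set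
AffinelyIndependent {n} {d} p = ∀ (c : Fin (suc d) → ℤ) →
  sumFinℤ c ≡ ℤ.+ 0 →
  (∀ e → sumFinℤ (λ i → c i ℤ.* p i e) ≡ ℤ.+ 0) →
  ∀ i → c i ≡ ℤ.+ 0

-- dim Q(M) ≥ d : Q(M) has d+1 affinely independent vertices
DimAtLeast : ∀ {n} → Matroid n → ℕ → Set
DimAtLeast {n} M d = ∃ λ (B : Fin (suc d) → Subset n) →
  (∀ i → isBase M (B i) ≡ true) × AffinelyIndependent (λ i → indicator (B i))

-- If dim Q(M) < |E| - 1, then M has a separator S with ∅ ≠ S ≠ E. Start from the partition
-- of E into singletons and a fixed base R. Whenever a base B meeting every class in as many
-- elements as R admits an exchange B - x + y with x and y in different classes, merge these
-- two classes: the indicator of the class of y takes a larger value on B - x + y than on all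
-- bases found so far, so B - x + y is a new affinely independent vertex of Q(M). After
-- |E| - 1 merges we would have |E| such vertices, so the process stops at a partition into
-- at least two classes that no exchange crosses, and each class is a separator.
-- For a separator S, (B ∩ S) ∪ (C ∖ S) is a base for all bases B, C, so a base is f-minimal
-- iff its parts on S and on E ∖ S are minimal for the restrictions of f. Hence f is
-- M-generic iff both restrictions are generic, and F(M) = F(M|S) · F(M|E ∖ S), a product of
-- two quasisymmetric functions without constant term.
module Submission where

open import Defs
open import Algebra.Bundles using (CommutativeMonoid)
import Algebra.Properties.CommutativeSemigroup as CommSemigroupProperties
import Algebra.Properties.Semiring.Sum as SemiringSum
open import Data.Bool using (Bool; true; false; _∧_; not; if_then_else_; T)
import Data.Bool.Properties as Boolₚ
open import Data.Empty using (⊥-elim)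
open import Data.Fin as Fin using (Fin; zero; suc; toℕ; punchIn; punchOut)
import Data.Fin.Properties as Finₚ
open import Data.Fin.Subset using (Subset; inside; outside; ∁)
open import Data.Fin.Subset.Properties using (anySubset?)
open import Data.Integer using (ℤ; 0ℤ) renaming (+_ to pos; _+_ to _+ℤ_; _*_ to _*ℤ_; _-_ to _-ℤ_)
import Data.Integer.Properties as ℤₚ
import Data.Integer.Tactic.RingSolver as ℤ-Solver
open import Data.List as List using (List; []; _∷_; map; filter; concatMap; _++_; length; zipWith; allFin)
open import Data.List.Extrema.Nat using (argmin; f[argmin]≤f[xs]; argmin-all)
import Data.List.Properties as Listₚ
open import Data.List.Membership.Propositional using (_∈_)
open import Data.List.Membership.Propositional.Properties
  using (∈-++⁺ˡ; ∈-++⁺ʳ; ∈-map⁺; ∈-map⁻; ∈-filter⁺; ∈-filter⁻; ∈-allFin)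
open import Data.List.Relation.Unary.All as All using (All; []; _∷_)
import Data.List.Relation.Unary.AllPairs as AllPairs
open import Data.List.Relation.Unary.Any using (here; there)
open import Data.List.Relation.Unary.Unique.Propositional using (Unique)
import Data.List.Relation.Unary.Unique.Propositional.Properties as Uniqueₚ
open import Data.Maybe as Maybe using (Maybe; just; nothing)
open import Data.Nat using (ℕ; zero; suc; _+_; _*_; _∸_; _≤_; _<_; _≤ᵇ_; _≡ᵇ_; _≤?_; _≟_; z≤n; s≤s)
open import Data.Nat.Induction using (<-wellFounded)
open import Data.Nat.Properties
import Data.Nat.Tactic.RingSolver as ℕ-Solver
open import Data.Product using (∃; ∃₂; _×_; _,_; proj₁; proj₂)
open import Data.Sum using (_⊎_; inj₁; inj₂)
open import Data.Vec as Vec using (Vec; []; _∷_; lookup; _[_]≔_; tabulate)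
import Data.Vec.Functional as Vector
import Data.Vec.Properties as Vecₚ
open import Function using (_∘_; _⇔_; mk⇔; Equivalence)
open import Induction.WellFounded using (Acc; acc)
open import Relation.Binary.PropositionalEquality
open import Relation.Nullary using (¬_; yes; no; Dec; does; proof)
import Relation.Nullary.Decidable as Dec
open import Relation.Nullary.Decidable using (_×-dec_; _→-dec_; ¬?; map′; decidable-stable; dec-true; dec-false)
open import Relation.Nullary.Reflects using (Reflects; fromEquivalence; det; T-reflects)
open import Relation.Unary using (Decidable)

𝟙 : Bool → ℕ
𝟙 b = if b then 1 else 0

T-⇔⇒≡ : ∀ {a b} → (T a → T b) → (T b → T a) → a ≡ b
T-⇔⇒≡ {b = b} to from = det (fromEquivalence to from) (T-reflects b)

𝟙-∧ : ∀ a b → 𝟙 (a ∧ b) ≡ 𝟙 a * 𝟙 b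
𝟙-∧ true  b = sym (+-identityʳ (𝟙 b))
𝟙-∧ false b = refl

module ∑ℕ = SemiringSum +-*-semiring
module +-CS = CommSemigroupProperties +-commutativeSemigroup
module *-CS = CommSemigroupProperties *-commutativeSemigroup
module ∧-CS = CommSemigroupProperties (CommutativeMonoid.commutativeSemigroup Boolₚ.∧-commutativeMonoid)
module ∑ℤ = SemiringSum ℤₚ.+-*-semiring

sumFinℕ≡sum : ∀ {k} (a : Fin k → ℕ) → sumFinℕ a ≡ ∑ℕ.sum a
sumFinℕ≡sum {zero}  a = refl
sumFinℕ≡sum {suc k} a = cong (a zero +_) (sumFinℕ≡sum (a ∘ suc))

sumFinℤ≡sum : ∀ {k} (a : Fin k → ℤ) → sumFinℤ a ≡ ∑ℤ.sum a
sumFinℤ≡sum {zero}  a = refl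
sumFinℤ≡sum {suc k} a = cong (λ s → a zero +ℤ s) (sumFinℤ≡sum (a ∘ suc))

sumFinℕ-cong : ∀ {k} {a b : Fin k → ℕ} → (∀ i → a i ≡ b i) → sumFinℕ a ≡ sumFinℕ b
sumFinℕ-cong {a = a} {b} eq = begin
  sumFinℕ a  ≡⟨ sumFinℕ≡sum a ⟩
  ∑ℕ.sum a   ≡⟨ ∑ℕ.sum-cong-≗ eq ⟩
  ∑ℕ.sum b   ≡⟨ sumFinℕ≡sum b ⟨
  sumFinℕ b  ∎
  where open ≡-Reasoning

sumFinℕ-+ : ∀ {k} (a b : Fin k → ℕ) → sumFinℕ (λ i → a i + b i) ≡ sumFinℕ a + sumFinℕ b
sumFinℕ-+ a b = begin
  sumFinℕ (λ i → a i + b i)  ≡⟨ sumFinℕ≡sum (λ i → a i + b i) ⟩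
  ∑ℕ.sum (λ i → a i + b i)   ≡⟨ ∑ℕ.∑-distrib-+ a b ⟩
  ∑ℕ.sum a + ∑ℕ.sum b        ≡⟨ cong₂ _+_ (sumFinℕ≡sum a) (sumFinℕ≡sum b) ⟨
  sumFinℕ a + sumFinℕ b      ∎
  where open ≡-Reasoning

sumFinℕ-*ˡ : ∀ {k} (c : ℕ) (a : Fin k → ℕ) → sumFinℕ (λ i → c * a i) ≡ c * sumFinℕ a
sumFinℕ-*ˡ c a = begin
  sumFinℕ (λ i → c * a i)  ≡⟨ sumFinℕ≡sum (λ i → c * a i) ⟩
  ∑ℕ.sum (λ i → c * a i)   ≡⟨ ∑ℕ.*-distribˡ-sum c a ⟨
  c * ∑ℕ.sum a             ≡⟨ cong (c *_) (sumFinℕ≡sum a) ⟨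
  c * sumFinℕ a            ∎
  where open ≡-Reasoning

sumFinℕ-zero : ∀ k → sumFinℕ {k} (λ _ → 0) ≡ 0
sumFinℕ-zero k = trans (sumFinℕ≡sum {k} (λ _ → 0)) (∑ℕ.sum-replicate-zero k)

sumFinℕ-pointwise-update : ∀ {k} (a b : Fin k → ℕ) (x : Fin k) → (∀ i → x ≢ i → a i ≡ b i) →
  sumFinℕ a + b x ≡ sumFinℕ b + a x
sumFinℕ-pointwise-update {suc k} a b x agree = begin
  sumFinℕ a + b x                       ≡⟨ cong (_+ b x) (sumFinℕ≡sum a) ⟩
  ∑ℕ.sum a + b x                        ≡⟨ cong (_+ b x) (∑ℕ.sum-remove {i = x} a) ⟩
  a x + ∑ℕ.sum (a ∘ punchIn x) + b x    ≡⟨ cong (λ s → a x + s + b x) (∑ℕ.sum-cong-≗ λ i → agree _ (Finₚ.punchInᵢ≢i x i ∘ sym)) ⟩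
  a x + ∑ℕ.sum (b ∘ punchIn x) + b x    ≡⟨ +-CS.xy∙z≈zy∙x (a x) _ (b x) ⟩
  b x + ∑ℕ.sum (b ∘ punchIn x) + a x    ≡⟨ cong (_+ a x) (∑ℕ.sum-remove {i = x} b) ⟨
  ∑ℕ.sum b + a x                        ≡⟨ cong (_+ a x) (sumFinℕ≡sum b) ⟨
  sumFinℕ b + a x                       ∎
  where open ≡-Reasoning

sumFinℤ-cong : ∀ {k} {a b : Fin k → ℤ} → (∀ i → a i ≡ b i) → sumFinℤ a ≡ sumFinℤ b
sumFinℤ-cong {a = a} {b} eq = begin
  sumFinℤ a  ≡⟨ sumFinℤ≡sum a ⟩
  ∑ℤ.sum a   ≡⟨ ∑ℤ.sum-cong-≗ eq ⟩
  ∑ℤ.sum b   ≡⟨ sumFinℤ≡sum b ⟨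
  sumFinℤ b  ∎
  where open ≡-Reasoning

sumFinℤ-*ˡ : ∀ {k} (c : ℤ) (a : Fin k → ℤ) → sumFinℤ (λ i → c *ℤ a i) ≡ c *ℤ sumFinℤ a
sumFinℤ-*ˡ c a = begin
  sumFinℤ (λ i → c *ℤ a i)  ≡⟨ sumFinℤ≡sum (λ i → c *ℤ a i) ⟩
  ∑ℤ.sum (λ i → c *ℤ a i)   ≡⟨ ∑ℤ.*-distribˡ-sum c a ⟨
  c *ℤ ∑ℤ.sum a             ≡⟨ cong (c *ℤ_) (sumFinℤ≡sum a) ⟨
  c *ℤ sumFinℤ a            ∎
  where open ≡-Reasoning

sumFinℤ-comm : ∀ {k l} (a : Fin k → Fin l → ℤ) →
  sumFinℤ (λ i → sumFinℤ (λ j → a i j)) ≡ sumFinℤ (λ j → sumFinℤ (λ i → a i j))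
sumFinℤ-comm a = begin
  sumFinℤ (λ i → sumFinℤ (λ j → a i j))  ≡⟨ sumFinℤ≡sum (λ i → sumFinℤ (λ j → a i j)) ⟩
  ∑ℤ.sum (λ i → sumFinℤ (λ j → a i j))   ≡⟨ ∑ℤ.sum-cong-≗ (λ i → sumFinℤ≡sum (a i)) ⟩
  ∑ℤ.sum (λ i → ∑ℤ.sum (λ j → a i j))    ≡⟨ ∑ℤ.∑-comm a ⟩
  ∑ℤ.sum (λ j → ∑ℤ.sum (λ i → a i j))    ≡⟨ ∑ℤ.sum-cong-≗ (λ j → sumFinℤ≡sum (λ i → a i j)) ⟨
  ∑ℤ.sum (λ j → sumFinℤ (λ i → a i j))   ≡⟨ sumFinℤ≡sum (λ j → sumFinℤ (λ i → a i j)) ⟨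
  sumFinℤ (λ j → sumFinℤ (λ i → a i j))  ∎
  where open ≡-Reasoning

sumFinℤ-zero : ∀ k → sumFinℤ {k} (λ _ → 0ℤ) ≡ 0ℤ
sumFinℤ-zero k = trans (sumFinℤ≡sum {k} (λ _ → 0ℤ)) (∑ℤ.sum-replicate-zero k)

sumFinℤ-pos : ∀ {k} (a : Fin k → ℕ) → sumFinℤ (λ i → pos (a i)) ≡ pos (sumFinℕ a)
sumFinℤ-pos {zero}  a = refl
sumFinℤ-pos {suc k} a = trans (cong (λ s → pos (a zero) +ℤ s) (sumFinℤ-pos (a ∘ suc))) (sym (ℤₚ.pos-+ (a zero) _))

∈∧∉⇒≢ : ∀ {n} {B : Subset n} {x y} → lookup B x ≡ true → lookup B y ≡ false → x ≢ y
∈∧∉⇒≢ x∈B y∉B refl with trans (sym x∈B) y∉B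
... | ()

exch : ∀ {n} → Subset n → Fin n → Fin n → Subset n
exch B x y = (B [ x ]≔ outside) [ y ]≔ inside

select : ∀ {n} {A : Set} → Subset n → Vec A n → Vec A n → Vec A n
select S u v = tabulate (λ e → if lookup S e then lookup u e else lookup v e)

lookup-select : ∀ {n} {A : Set} (S : Subset n) (u v : Vec A n) e →
  lookup (select S u v) e ≡ (if lookup S e then lookup u e else lookup v e)
lookup-select S u v e = Vecₚ.lookup∘tabulate _ e

lookup-exch-new : ∀ {n} (B : Subset n) x y → lookup (exch B x y) y ≡ true
lookup-exch-new B x y = Vecₚ.lookup∘update y (B [ x ]≔ outside) true

lookup-exch-old : ∀ {n} (B : Subset n) {x y} → x ≢ y → lookup (exch B x y) x ≡ false
lookup-exch-old B {x} x≢y = trans (Vecₚ.lookup∘update′ x≢y (B [ x ]≔ outside) true) (Vecₚ.lookup∘update x B false)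

lookup-exch-other : ∀ {n} (B : Subset n) {x y e} → e ≢ x → e ≢ y → lookup (exch B x y) e ≡ lookup B e
lookup-exch-other B {x} e≢x e≢y = trans (Vecₚ.lookup∘update′ e≢y (B [ x ]≔ outside) true) (Vecₚ.lookup∘update′ e≢x B false)

module _ {n} (f : Fin n → ℕ) where

  weight-update : ∀ B x b → weight f (B [ x ]≔ b) + (if lookup B x then f x else 0) ≡ weight f B + (if b then f x else 0)
  weight-update B x b = begin
    weight f (B [ x ]≔ b) + term B x  ≡⟨ sumFinℕ-pointwise-update (term (B [ x ]≔ b)) (term B) x agree ⟩
    weight f B + term (B [ x ]≔ b) x  ≡⟨ cong (λ c → weight f B + (if c then f x else 0)) (Vecₚ.lookup∘update x B b) ⟩
    weight f B + (if b then f x else 0) ∎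
    where
    open ≡-Reasoning
    term : Subset n → Fin n → ℕ
    term V e = if lookup V e then f e else 0
    agree : ∀ e → x ≢ e → term (B [ x ]≔ b) e ≡ term B e
    agree e x≢e = cong (λ c → if c then f e else 0) (Vecₚ.lookup∘update′ (x≢e ∘ sym) B b)

  weight-exch : ∀ {B x y} → lookup B x ≡ true → lookup B y ≡ false →
    weight f (exch B x y) + f x ≡ weight f B + f y
  weight-exch {B} {x} {y} x∈B y∉B = begin
    weight f (exch B x y) + f x  ≡⟨ cong (_+ f x) added ⟩
    weight f B₁ + f y + f x      ≡⟨ +-CS.xy∙z≈xz∙y (weight f B₁) (f y) (f x) ⟩
    weight f B₁ + f x + f y      ≡⟨ cong (_+ f y) removed ⟩
    weight f B + f y             ∎
    where
    open ≡-Reasoning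
    B₁ = B [ x ]≔ outside
    removed : weight f B₁ + f x ≡ weight f B
    removed = begin
      weight f B₁ + f x                               ≡⟨ cong (λ c → weight f B₁ + (if c then f x else 0)) x∈B ⟨
      weight f B₁ + (if lookup B x then f x else 0)   ≡⟨ weight-update B x false ⟩
      weight f B + 0                                  ≡⟨ +-identityʳ _ ⟩
      weight f B                                      ∎
    y∉B₁ : lookup B₁ y ≡ false
    y∉B₁ = trans (Vecₚ.lookup∘update′ (∈∧∉⇒≢ {B = B} x∈B y∉B ∘ sym) B false) y∉B
    added : weight f (exch B x y) ≡ weight f B₁ + f y
    added = begin
      weight f (exch B x y)                                        ≡⟨ +-identityʳ _ ⟨
      weight f (exch B x y) + 0                                    ≡⟨ cong (λ c → weight f (exch B x y) + (if c then f y else 0)) y∉B₁ ⟨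
      weight f (exch B x y) + (if lookup B₁ y then f y else 0)     ≡⟨ weight-update B₁ y true ⟩
      weight f B₁ + f y                                            ∎

weight-+ : ∀ {n} (f g : Fin n → ℕ) B → weight (λ e → f e + g e) B ≡ weight f B + weight g B
weight-+ f g B = trans (sumFinℕ-cong split) (sumFinℕ-+ (λ e → if lookup B e then f e else 0) (λ e → if lookup B e then g e else 0))
  where
  split : ∀ e → (if lookup B e then f e + g e else 0) ≡ (if lookup B e then f e else 0) + (if lookup B e then g e else 0)
  split e with lookup B e
  ... | true  = refl
  ... | false = refl

term-vanishes : ∀ (c : Bool) {a} → a ≡ 0 → (if c then a else 0) ≡ 0
term-vanishes true  a≡0 = a≡0
term-vanishes false _   = refl

module _ {n} (S : Subset n) (f : Fin n → ℕ) where

  weight-select-inside : (∀ e → lookup S e ≡ false → f e ≡ 0) → ∀ B C → weight f (select S B C) ≡ weight f B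
  weight-select-inside supported B C = sumFinℕ-cong same
    where
    same : ∀ e → (if lookup (select S B C) e then f e else 0) ≡ (if lookup B e then f e else 0)
    same e rewrite lookup-select S B C e with lookup S e in e∈S
    ... | true  = refl
    ... | false = trans (term-vanishes (lookup C e) (supported e e∈S)) (sym (term-vanishes (lookup B e) (supported e e∈S)))

  weight-select-outside : (∀ e → lookup S e ≡ true → f e ≡ 0) → ∀ B C → weight f (select S B C) ≡ weight f C
  weight-select-outside supported B C = sumFinℕ-cong same
    where
    same : ∀ e → (if lookup (select S B C) e then f e else 0) ≡ (if lookup C e then f e else 0)
    same e rewrite lookup-select S B C e with lookup S e in e∈S
    ... | false = refl
    ... | true  = trans (term-vanishes (lookup B e) (supported e e∈S)) (sym (term-vanishes (lookup C e) (supported e e∈S)))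

argmin-exists : ∀ {A : Set} (f : A → ℕ) {P : A → Set} (xs : List A) → All P xs → (∀ {x} → P x → x ∈ xs) →
  ∀ {x₀} → P x₀ → ∃ λ x → P x × ∀ {z} → P z → f x ≤ f z
argmin-exists f xs all-P complete {x₀} Px₀ =
  argmin f x₀ xs , argmin-all f Px₀ all-P , λ Pz → All.lookup (f[argmin]≤f[xs] x₀ xs) (complete Pz)

min-witness : ∀ {n} {P : Fin n → Set} → Decidable P → (f : Fin n → ℕ) → ∃ P →
  ∃ λ x → P x × ∀ {z} → P z → f x ≤ f z
min-witness {n} P? f (x₀ , Px₀) =
  argmin-exists f (filter P? (allFin n)) (All.tabulate (proj₂ ∘ ∈-filter⁻ P? {xs = allFin n})) (∈-filter⁺ P? (∈-allFin _)) Px₀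

lookup-∁ : ∀ {n} (S : Subset n) e → lookup (∁ S) e ≡ not (lookup S e)
lookup-∁ S e = Vecₚ.lookup-map e not S

lookup-extensionality : ∀ {n} {A : Set} {u v : Vec A n} → (∀ i → lookup u i ≡ lookup v i) → u ≡ v
lookup-extensionality {u = u} {v} eq =
  trans (sym (Vecₚ.tabulate∘lookup u)) (trans (Vecₚ.tabulate-cong eq) (Vecₚ.tabulate∘lookup v))

difference-or-⊆ : ∀ {n} (A B : Subset n) →
  (∃ λ e → lookup A e ≡ true × lookup B e ≡ false) ⊎ (∀ e → lookup A e ≡ true → lookup B e ≡ true)
difference-or-⊆ A B with Finₚ.any? (λ e → (lookup A e Boolₚ.≟ true) ×-dec (lookup B e Boolₚ.≟ false))
... | yes witness = inj₁ witness
... | no none     = inj₂ λ e e∈A → Boolₚ.¬-not λ e∉B → none (e , e∈A , e∉B)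

exch-exch : ∀ {n} {B : Subset n} {x y} → lookup B x ≡ true → lookup B y ≡ false → exch (exch B x y) y x ≡ B
exch-exch {B = B} {x} {y} x∈B y∉B = lookup-extensionality pointwise
  where
  x≢y = ∈∧∉⇒≢ {B = B} x∈B y∉B
  pointwise : ∀ e → lookup (exch (exch B x y) y x) e ≡ lookup B e
  pointwise e with e Fin.≟ x | e Fin.≟ y
  ... | yes refl | _        = trans (lookup-exch-new (exch B x y) y x) (sym x∈B)
  ... | no e≢x   | yes refl = trans (lookup-exch-old (exch B x y) (x≢y ∘ sym)) (sym y∉B)
  ... | no e≢x   | no e≢y   = trans (lookup-exch-other (exch B x y) e≢y e≢x) (lookup-exch-other B e≢x e≢y)

diffSize : ∀ {n} → Subset n → Subset n → ℕ
diffSize A B = weight (λ e → if lookup B e then 0 else 1) A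

diffSize-exch : ∀ {n} {A B : Subset n} {x y} → lookup A x ≡ true → lookup A y ≡ false → lookup B x ≡ false → lookup B y ≡ true →
  diffSize (exch A x y) B < diffSize A B
diffSize-exch {A = A} {B} {x} {y} x∈A y∉A x∉B y∈B = ≤-reflexive (begin
  suc (diffSize (exch A x y) B)                             ≡⟨ +-comm 1 _ ⟩
  diffSize (exch A x y) B + 1                               ≡⟨ cong (λ c → diffSize (exch A x y) B + (if c then 0 else 1)) x∉B ⟨
  diffSize (exch A x y) B + (if lookup B x then 0 else 1)   ≡⟨ weight-exch (λ e → if lookup B e then 0 else 1) {A} x∈A y∉A ⟩
  diffSize A B + (if lookup B y then 0 else 1)              ≡⟨ cong (λ c → diffSize A B + (if c then 0 else 1)) y∈B ⟩
  diffSize A B + 0                                          ≡⟨ +-identityʳ _ ⟩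
  diffSize A B                                              ∎)
  where open ≡-Reasoning

∈-allSubsets : ∀ {n} (S : Subset n) → S ∈ allSubsets n
∈-allSubsets []                  = here refl
∈-allSubsets (outside ∷ S)       = ∈-++⁺ˡ (∈-map⁺ (outside ∷_) (∈-allSubsets S))
∈-allSubsets {suc n} (inside ∷ S) = ∈-++⁺ʳ (List.map (outside ∷_) (allSubsets n)) (∈-map⁺ (inside ∷_) (∈-allSubsets S))

allSubsets-unique : ∀ n → Unique (allSubsets n)
allSubsets-unique zero    = [] AllPairs.∷ AllPairs.[]
allSubsets-unique (suc n) =
  Uniqueₚ.++⁺ (Uniqueₚ.map⁺ ∷-injectiveʳ (allSubsets-unique n)) (Uniqueₚ.map⁺ ∷-injectiveʳ (allSubsets-unique n)) disjoint
  where
  ∷-injectiveʳ : ∀ {b} {S S′ : Subset n} → b Vec.∷ S ≡ b ∷ S′ → S ≡ S′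
  ∷-injectiveʳ refl = refl
  disjoint : ∀ {S} → ¬ (S ∈ List.map (outside ∷_) (allSubsets n) × S ∈ List.map (inside ∷_) (allSubsets n))
  disjoint (S∈outside , S∈inside) with ∈-map⁻ (outside ∷_) S∈outside | ∈-map⁻ (inside ∷_) S∈inside
  ... | _ , _ , refl | _ , _ , ()

module _ {A : Set} (p : A → Bool) where

  allᵇ⇔ : ∀ xs → T (allᵇ p xs) ⇔ (∀ {x} → x ∈ xs → T (p x))
  allᵇ⇔ []       = mk⇔ (λ _ ()) (λ _ → _)
  allᵇ⇔ (y ∷ xs) = mk⇔
    (λ all∷ → λ { (here refl) → proj₁ (Equivalence.to Boolₚ.T-∧ all∷)
                ; (there x∈) → Equivalence.to (allᵇ⇔ xs) (proj₂ (Equivalence.to Boolₚ.T-∧ all∷)) x∈ })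
    (λ all∈ → Equivalence.from Boolₚ.T-∧ (all∈ (here refl) , Equivalence.from (allᵇ⇔ xs) (λ x∈ → all∈ (there x∈))))

  countᵇ≡0⇒ : ∀ {xs} → countᵇ p xs ≡ 0 → ∀ {x} → x ∈ xs → ¬ T (p x)
  countᵇ≡0⇒ {y ∷ xs} none y∈ with p y in py
  ... | true  = ⊥-elim (1+n≢0 none)
  ... | false with y∈
  ...   | here refl = subst T py
  ...   | there x∈  = countᵇ≡0⇒ none x∈

  countᵇ≡1⇒witness : ∀ {xs} → countᵇ p xs ≡ 1 → ∃ λ x → x ∈ xs × T (p x)
  countᵇ≡1⇒witness {y ∷ xs} one with p y in py
  ... | true  = y , here refl , subst T (sym py) _
  ... | false with countᵇ≡1⇒witness one
  ...   | x , x∈ , px = x , there x∈ , px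

  countᵇ≡1⇒unique : ∀ {xs} → countᵇ p xs ≡ 1 → ∀ {x y} → x ∈ xs → y ∈ xs → T (p x) → T (p y) → x ≡ y
  countᵇ≡1⇒unique {z ∷ xs} one x∈ y∈ px py with p z in pz
  countᵇ≡1⇒unique {z ∷ xs} one (here refl) (here refl) px py | true = refl
  countᵇ≡1⇒unique {z ∷ xs} one (here refl) (there y∈) px py | true = ⊥-elim (countᵇ≡0⇒ (suc-injective one) y∈ py)
  countᵇ≡1⇒unique {z ∷ xs} one (there x∈) _           px py | true = ⊥-elim (countᵇ≡0⇒ (suc-injective one) x∈ px)
  countᵇ≡1⇒unique {z ∷ xs} one (here refl) _          px py | false = ⊥-elim (subst T pz px)
  countᵇ≡1⇒unique {z ∷ xs} one (there x∈) (here refl) px py | false = ⊥-elim (subst T pz py)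
  countᵇ≡1⇒unique {z ∷ xs} one (there x∈) (there y∈)  px py | false = countᵇ≡1⇒unique one x∈ y∈ px py

  countᵇ≡0⇐ : ∀ {xs} → (∀ {x} → x ∈ xs → ¬ T (p x)) → countᵇ p xs ≡ 0
  countᵇ≡0⇐ {[]}     none = refl
  countᵇ≡0⇐ {y ∷ xs} none with p y in py
  ... | true  = ⊥-elim (none (here refl) (subst T (sym py) _))
  ... | false = countᵇ≡0⇐ (λ x∈ → none (there x∈))

  countᵇ≡1⇐ : ∀ {xs} → Unique xs → ∀ {x} → x ∈ xs → T (p x) → (∀ {y} → y ∈ xs → T (p y) → y ≡ x) → countᵇ p xs ≡ 1
  countᵇ≡1⇐ {y ∷ xs} (y∉xs AllPairs.∷ unique) x∈ px only with p y in py
  ... | true  = cong suc (countᵇ≡0⇐ λ z∈ pz → All.lookup y∉xs z∈ (trans (only (here refl) (subst T (sym py) _)) (sym (only (there z∈) pz))))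
  ... | false with x∈
  ...   | here refl = ⊥-elim (subst T py px)
  ...   | there x∈xs = countᵇ≡1⇐ unique x∈xs px (λ y∈ → only (there y∈))

all-subsets? : ∀ {n} {P : Subset n → Set} → Decidable P → Dec (∀ S → P S)
all-subsets? P? = map′ (λ no-counterexample S → decidable-stable (P? S) (no-counterexample ∘ (S ,_)))
                       (λ all (S , ¬PS) → ¬PS (all S))
                       (¬? (anySubset? (¬? ∘ P?)))

AgreeOn : ∀ {n} → Subset n → Subset n → Subset n → Set
AgreeOn T B C = ∀ e → lookup T e ≡ true → lookup B e ≡ lookup C e

agreeOn? : ∀ {n} (T B C : Subset n) → Dec (AgreeOn T B C)
agreeOn? T B C = Finₚ.all? (λ e → (lookup T e Boolₚ.≟ true) →-dec (lookup B e Boolₚ.≟ lookup C e))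

module _ {n} (M : Matroid n) where

  IsBase : Subset n → Set
  IsBase B = isBase M B ≡ true

  base-exchange : ∀ {B₁ B₂ x} → IsBase B₁ → IsBase B₂ → lookup B₁ x ≡ true → lookup B₂ x ≡ false →
    ∃ λ y → lookup B₂ y ≡ true × lookup B₁ y ≡ false × IsBase (exch B₁ x y)
  base-exchange {B₁} {B₂} {x} b₁ b₂ x∈B₁ x∉B₂
    with exchange M B₁ B₂ b₁ b₂ x (Vecₚ.lookup⇒[]= x B₁ x∈B₁) (λ x∈B₂ → ∈∧∉⇒≢ {B = B₂} (Vecₚ.[]=⇒lookup x∈B₂) x∉B₂ refl)
  ... | y , y∈B₂ , y∉B₁ , b = y , Vecₚ.[]=⇒lookup y∈B₂ , Boolₚ.¬-not (y∉B₁ ∘ Vecₚ.lookup⇒[]= y B₁) , b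

  base-⊆⇒≡ : ∀ {B₁ B₂} → IsBase B₁ → IsBase B₂ → (∀ e → lookup B₁ e ≡ true → lookup B₂ e ≡ true) → B₁ ≡ B₂
  base-⊆⇒≡ {B₁} {B₂} b₁ b₂ B₁⊆B₂ with difference-or-⊆ B₂ B₁
  ... | inj₁ (x , x∈B₂ , x∉B₁) =
    let (y , y∈B₁ , y∉B₂ , _) = base-exchange b₂ b₁ x∈B₂ x∉B₁ in ⊥-elim (∈∧∉⇒≢ {B = B₂} (B₁⊆B₂ y y∈B₁) y∉B₂ refl)
  ... | inj₂ B₂⊆B₁ = lookup-extensionality same
    where
    same : ∀ e → lookup B₁ e ≡ lookup B₂ e
    same e with lookup B₁ e in e∈B₁ | lookup B₂ e in e∈B₂
    ... | true  | true  = refl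
    ... | false | false = refl
    ... | true  | false = trans (sym (B₁⊆B₂ e e∈B₁)) e∈B₂
    ... | false | true  = trans (sym e∈B₁) (B₂⊆B₁ e e∈B₂)

  exch-recovers : ∀ {B₁ B₂ x y} → IsBase B₁ → IsBase (exch B₂ x y) → lookup B₂ x ≡ true → lookup B₂ y ≡ false →
    lookup B₁ y ≡ true → (∀ e → lookup (B₂ [ x ]≔ outside) e ≡ true → lookup B₁ e ≡ true) → B₂ ≡ exch B₁ y x
  exch-recovers {B₁} {B₂} {x} {y} b₁ b x∈B₂ y∉B₂ y∈B₁ B₂-x⊆B₁ =
    trans (sym (exch-exch x∈B₂ y∉B₂)) (cong (λ B → exch B y x) (base-⊆⇒≡ b b₁ B₂-x+y⊆B₁))
    where
    B₂-x+y⊆B₁ : ∀ e → lookup (exch B₂ x y) e ≡ true → lookup B₁ e ≡ true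
    B₂-x+y⊆B₁ e e∈ with e Fin.≟ y | e Fin.≟ x
    ... | yes refl | _        = y∈B₁
    ... | no e≢y   | yes refl = ⊥-elim (∈∧∉⇒≢ {B = exch B₂ x y} e∈ (lookup-exch-old B₂ (∈∧∉⇒≢ {B = B₂} x∈B₂ y∉B₂)) refl)
    ... | no e≢y   | no e≢x   =
      B₂-x⊆B₁ e (trans (Vecₚ.lookup∘update′ e≢x B₂ outside) (trans (sym (lookup-exch-other B₂ e≢x e≢y)) e∈))

  -- If B₂ - x ⊆ B₁, exchanging x out of B₂ lands on B₁; otherwise exchanging some
  -- x′ ∈ B₂ ∖ B₁ with x′ ≢ x out of B₂ moves B₂ closer to B₁.
  dual-exchange : ∀ {B₁ B₂ x} → IsBase B₁ → IsBase B₂ → lookup B₂ x ≡ true → lookup B₁ x ≡ false →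
    ∃ λ y → lookup B₁ y ≡ true × lookup B₂ y ≡ false × IsBase (exch B₁ y x)
  dual-exchange b₁ b₂ = go b₁ b₂ (<-wellFounded _)
    where
    go : ∀ {B₁ B₂ x} → IsBase B₁ → IsBase B₂ → Acc _<_ (diffSize B₂ B₁) → lookup B₂ x ≡ true → lookup B₁ x ≡ false →
      ∃ λ y → lookup B₁ y ≡ true × lookup B₂ y ≡ false × IsBase (exch B₁ y x)
    go {B₁} {B₂} {x} b₁ b₂ (acc rec) x∈B₂ x∉B₁ with difference-or-⊆ (B₂ [ x ]≔ outside) B₁
    ... | inj₁ (x′ , x′∈B₂-x , x′∉B₁) = shrink (base-exchange b₂ b₁ x′∈B₂ x′∉B₁)
      where
      x′≢x : x′ ≢ x
      x′≢x refl = ∈∧∉⇒≢ {B = B₂ [ x ]≔ outside} x′∈B₂-x (Vecₚ.lookup∘update x B₂ outside) refl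
      x′∈B₂ : lookup B₂ x′ ≡ true
      x′∈B₂ = trans (sym (Vecₚ.lookup∘update′ x′≢x B₂ outside)) x′∈B₂-x
      shrink : (∃ λ z → lookup B₁ z ≡ true × lookup B₂ z ≡ false × IsBase (exch B₂ x′ z)) →
        ∃ λ y → lookup B₁ y ≡ true × lookup B₂ y ≡ false × IsBase (exch B₁ y x)
      shrink (z , z∈B₁ , z∉B₂ , b₂′) = transfer (go b₁ b₂′ (rec closer) x∈B₂′ x∉B₁)
        where
        closer = diffSize-exch {A = B₂} {B₁} x′∈B₂ z∉B₂ x′∉B₁ z∈B₁
        x∈B₂′ : lookup (exch B₂ x′ z) x ≡ true
        x∈B₂′ = trans (lookup-exch-other B₂ (x′≢x ∘ sym) (∈∧∉⇒≢ {B = B₁} z∈B₁ x∉B₁ ∘ sym)) x∈B₂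
        transfer : (∃ λ y → lookup B₁ y ≡ true × lookup (exch B₂ x′ z) y ≡ false × IsBase (exch B₁ y x)) →
          ∃ λ y → lookup B₁ y ≡ true × lookup B₂ y ≡ false × IsBase (exch B₁ y x)
        transfer (y , y∈B₁ , y∉B₂′ , b) = y , y∈B₁ , trans (sym (lookup-exch-other B₂ y≢x′ y≢z)) y∉B₂′ , b
          where
          y≢x′ = ∈∧∉⇒≢ {B = B₁} y∈B₁ x′∉B₁
          y≢z : y ≢ z
          y≢z refl = ∈∧∉⇒≢ {B = exch B₂ x′ z} (lookup-exch-new B₂ x′ z) y∉B₂′ refl
    ... | inj₂ B₂-x⊆B₁ with base-exchange b₂ b₁ x∈B₂ x∉B₁
    ...   | y , y∈B₁ , y∉B₂ , b = y , y∈B₁ , y∉B₂ , subst IsBase (exch-recovers b₁ b x∈B₂ y∉B₂ y∈B₁ B₂-x⊆B₁) b₂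

  IsMinimal : (Fin n → ℕ) → Subset n → Set
  IsMinimal f B = IsBase B × (∀ B′ → IsBase B′ → weight f B ≤ weight f B′)

  IsLocallyMinimal : (Fin n → ℕ) → Subset n → Set
  IsLocallyMinimal f B = ∀ {x y} → lookup B x ≡ true → lookup B y ≡ false → IsBase (exch B x y) → f x ≤ f y

  minimal⇒locallyMinimal : ∀ {f B} → IsMinimal f B → IsLocallyMinimal f B
  minimal⇒locallyMinimal {f} {B} (_ , least) {x} {y} x∈B y∉B b =
    +-cancelˡ-≤ (weight f B) (f x) (f y) (≤-trans (+-monoˡ-≤ (f x) (least _ b)) (≤-reflexive (weight-exch f {B} x∈B y∉B)))

  -- For x ∈ B ∖ B′ with f x least, a dual exchange B′ - y + x is no heavier than B′ and closer to B.
  locallyMinimal⇒minimal : ∀ {f B} → IsBase B → IsLocallyMinimal f B → IsMinimal f B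
  locallyMinimal⇒minimal {f} {B} b local = b , λ B′ b′ → go b′ (<-wellFounded _)
    where
    go : ∀ {B′} → IsBase B′ → Acc _<_ (diffSize B′ B) → weight f B ≤ weight f B′
    go {B′} b′ (acc rec) with difference-or-⊆ B B′
    ... | inj₂ B⊆B′ = ≤-reflexive (cong (weight f) (base-⊆⇒≡ b b′ B⊆B′))
    ... | inj₁ witness = descend (min-witness (λ e → (lookup B e Boolₚ.≟ true) ×-dec (lookup B′ e Boolₚ.≟ false)) f witness)
      where
      descend : (∃ λ x → (lookup B x ≡ true × lookup B′ x ≡ false) × ∀ {z} → lookup B z ≡ true × lookup B′ z ≡ false → f x ≤ f z) →
        weight f B ≤ weight f B′
      descend (x , (x∈B , x∉B′) , x-least) with dual-exchange b′ b x∈B x∉B′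
      ... | y , y∈B′ , y∉B , b″ = ≤-trans (go b″ (rec closer)) lighter
        where
        fx≤fy : f x ≤ f y
        fx≤fy with dual-exchange b b′ y∈B′ y∉B
        ... | x′ , x′∈B , x′∉B′ , b‴ = ≤-trans (x-least (x′∈B , x′∉B′)) (local x′∈B y∉B b‴)
        closer : diffSize (exch B′ y x) B < diffSize B′ B
        closer = diffSize-exch {A = B′} {B} y∈B′ x∉B′ y∉B x∈B
        lighter : weight f (exch B′ y x) ≤ weight f B′
        lighter = +-cancelʳ-≤ (f y) _ _
          (≤-trans (≤-reflexive (weight-exch f {B′} y∈B′ x∉B′)) (+-monoʳ-≤ (weight f B′) fx≤fy))

  minimal-transfer : ∀ {f g B} → (∀ {a b} → f a ≤ f b → g a ≤ g b) → IsMinimal f B → IsMinimal g B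
  minimal-transfer mono minimal =
    locallyMinimal⇒minimal (proj₁ minimal) (λ x∈B y∉B b → mono (minimal⇒locallyMinimal minimal x∈B y∉B b))

  IsSeparator : Subset n → Set
  IsSeparator S = ∀ {B x y} → IsBase B → lookup B x ≡ true → lookup B y ≡ false → IsBase (exch B x y) →
    lookup S x ≡ lookup S y

  -- Exchanging from B towards C outside S stays outside S and leaves select S B C unchanged.
  separator-select : ∀ {S} → IsSeparator S → ∀ {B C} → IsBase B → IsBase C → IsBase (select S B C)
  separator-select {S} separator b c = go b c (<-wellFounded _)
    where
    go : ∀ {B C} → IsBase B → IsBase C → Acc _<_ (diffSize B C) → IsBase (select S B C)
    go {B} {C} b c (acc rec)
      with Finₚ.any? (λ e → (lookup B e Boolₚ.≟ true) ×-dec (lookup C e Boolₚ.≟ false) ×-dec (lookup S e Boolₚ.≟ false))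
    ... | yes (x , x∈B , x∉C , x∉S) = shift (base-exchange b c x∈B x∉C)
      where
      shift : (∃ λ y → lookup C y ≡ true × lookup B y ≡ false × IsBase (exch B x y)) → IsBase (select S B C)
      shift (y , y∈C , y∉B , b′) = subst IsBase (lookup-extensionality same) (go b′ c (rec closer))
        where
        y∉S = trans (sym (separator b x∈B y∉B b′)) x∉S
        closer = diffSize-exch {A = B} {C} x∈B y∉B x∉C y∈C
        same : ∀ e → lookup (select S (exch B x y) C) e ≡ lookup (select S B C) e
        same e rewrite lookup-select S (exch B x y) C e | lookup-select S B C e with lookup S e in e∈S
        ... | false = refl
        ... | true  = lookup-exch-other B (λ { refl → ∈∧∉⇒≢ {B = S} e∈S x∉S refl }) (λ { refl → ∈∧∉⇒≢ {B = S} e∈S y∉S refl })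
    ... | no none = subst IsBase (sym (lookup-extensionality same)) b
      where
      same : ∀ e → lookup (select S B C) e ≡ lookup B e
      same e rewrite lookup-select S B C e with lookup S e in e∈S
      ... | true = refl
      ... | false with lookup B e in e∈B | lookup C e in e∈C
      ...   | true  | true  = refl
      ...   | false | false = refl
      ...   | true  | false = ⊥-elim (none (e , e∈B , e∈C , e∈S))
      ...   | false | true with base-exchange c b e∈C e∈B
      ...     | y , y∈B , y∉C , c′ = ⊥-elim (none (y , y∈B , y∉C , trans (sym (separator c e∈C y∉C c′)) e∈S))

  isBase? : ∀ B → Dec (IsBase B)
  isBase? B = isBase M B Boolₚ.≟ true

  ∈-bases⁺ : ∀ {B} → IsBase B → B ∈ bases M
  ∈-bases⁺ {B} = ∈-filter⁺ isBase? (∈-allSubsets B)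

  ∈-bases⁻ : ∀ {B} → B ∈ bases M → IsBase B
  ∈-bases⁻ B∈ = proj₂ (∈-filter⁻ isBase? {xs = allSubsets n} B∈)

  bases-unique : Unique (bases M)
  bases-unique = Uniqueₚ.filter⁺ isBase? (allSubsets-unique n)

  minimal-exists : ∀ f → ∃ (IsMinimal f)
  minimal-exists f with argmin-exists (weight f) (bases M) (All.tabulate ∈-bases⁻) ∈-bases⁺ (proj₂ (nonempty M))
  ... | B , b , least = B , b , λ B′ b′ → least b′

  minimal? : ∀ f B → Dec (IsMinimal f B)
  minimal? f B = isBase? B ×-dec all-subsets? (λ B′ → isBase? B′ →-dec (weight f B ≤? weight f B′))

  minimalᵇ : (Fin n → ℕ) → Subset n → Bool
  minimalᵇ f B = allᵇ (λ B′ → weight f B ≤ᵇ weight f B′) (bases M)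

  minimalᵇ⇒ : ∀ {f B} → IsBase B → T (minimalᵇ f B) → IsMinimal f B
  minimalᵇ⇒ {f} {B} b t = b , λ B′ b′ → ≤ᵇ⇒≤ (weight f B) (weight f B′) (Equivalence.to (allᵇ⇔ _ (bases M)) t (∈-bases⁺ b′))

  minimalᵇ⇐ : ∀ {f B} → IsMinimal f B → T (minimalᵇ f B)
  minimalᵇ⇐ (_ , least) = Equivalence.from (allᵇ⇔ _ (bases M)) λ B′∈ → ≤⇒≤ᵇ (least _ (∈-bases⁻ B′∈))

  IsGeneric : (Fin n → ℕ) → Set
  IsGeneric f = ∃ λ B → IsMinimal f B × ∀ C → IsMinimal f C → C ≡ B

  T-isGeneric⇔ : ∀ f → T (isGeneric M f) ⇔ IsGeneric f
  T-isGeneric⇔ f = mk⇔ sound complete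
    where
    sound : T (isGeneric M f) → IsGeneric f
    sound t with ≡ᵇ⇒≡ _ 1 t
    ... | one with countᵇ≡1⇒witness (minimalᵇ f) one
    ...   | B , B∈ , tB = B , minimalᵇ⇒ (∈-bases⁻ B∈) tB ,
                          λ C minC → countᵇ≡1⇒unique (minimalᵇ f) one (∈-bases⁺ (proj₁ minC)) B∈ (minimalᵇ⇐ minC) tB
    complete : IsGeneric f → T (isGeneric M f)
    complete (B , minB , only) = ≡⇒≡ᵇ _ 1 (countᵇ≡1⇐ (minimalᵇ f) bases-unique (∈-bases⁺ (proj₁ minB)) (minimalᵇ⇐ minB)
                                                    (λ C∈ tC → only _ (minimalᵇ⇒ (∈-bases⁻ C∈) tC)))

  isGeneric-reflects : ∀ f → Reflects (IsGeneric f) (isGeneric M f)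
  isGeneric-reflects f = fromEquivalence (Equivalence.to (T-isGeneric⇔ f)) (Equivalence.from (T-isGeneric⇔ f))

  generic-transfer : ∀ {f g} → (∀ {a b} → f a ≤ f b → g a ≤ g b) → (∀ {a b} → g a ≤ g b → f a ≤ f b) → IsGeneric f → IsGeneric g
  generic-transfer f⇒g g⇒f (B , minB , only) = B , minimal-transfer f⇒g minB , λ C minC → only C (minimal-transfer g⇒f minC)

  isGeneric-transfer : ∀ {f g} → (∀ {a b} → f a ≤ f b → g a ≤ g b) → (∀ {a b} → g a ≤ g b → f a ≤ f b) →
    isGeneric M f ≡ isGeneric M g
  isGeneric-transfer {f} {g} f⇒g g⇒f = T-⇔⇒≡
    (Equivalence.from (T-isGeneric⇔ g) ∘ generic-transfer f⇒g g⇒f ∘ Equivalence.to (T-isGeneric⇔ f))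
    (Equivalence.from (T-isGeneric⇔ f) ∘ generic-transfer g⇒f f⇒g ∘ Equivalence.to (T-isGeneric⇔ g))

  MinimaAgreeOn : Subset n → (Fin n → ℕ) → Set
  MinimaAgreeOn T f = ∀ B C → IsMinimal f B → IsMinimal f C → AgreeOn T B C

  minimaAgreeOn? : ∀ T f → Dec (MinimaAgreeOn T f)
  minimaAgreeOn? T f = all-subsets? λ B → all-subsets? λ C → minimal? f B →-dec (minimal? f C →-dec agreeOn? T B C)

  -- For a separator T and f supported on T, genericity of f for the restriction M | T.
  genericOn : Subset n → (Fin n → ℕ) → Bool
  genericOn T f = does (minimaAgreeOn? T f)

  genericOn-transfer : ∀ T {f g} → (∀ {a b} → f a ≤ f b → g a ≤ g b) → (∀ {a b} → g a ≤ g b → f a ≤ f b) →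
    genericOn T f ≡ genericOn T g
  genericOn-transfer T {f} {g} f⇒g g⇒f =
    det (proof (minimaAgreeOn? T f)) (proof (Dec.map (mk⇔ from to) (minimaAgreeOn? T g)))
    where
    from : MinimaAgreeOn T g → MinimaAgreeOn T f
    from agree B C minB minC = agree B C (minimal-transfer f⇒g minB) (minimal-transfer f⇒g minC)
    to : MinimaAgreeOn T f → MinimaAgreeOn T g
    to agree B C minB minC = agree B C (minimal-transfer g⇒f minB) (minimal-transfer g⇒f minC)

  module _ {S} (separator : IsSeparator S) (f₁ f₂ : Fin n → ℕ)
           (f₁-inside : ∀ e → lookup S e ≡ false → f₁ e ≡ 0) (f₂-outside : ∀ e → lookup S e ≡ true → f₂ e ≡ 0) where

    private
      f : Fin n → ℕ
      f e = f₁ e + f₂ e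

      weight-split : ∀ B → weight f B ≡ weight f₁ B + weight f₂ B
      weight-split = weight-+ f₁ f₂

      weight-select : ∀ B C → weight f (select S B C) ≡ weight f₁ B + weight f₂ C
      weight-select B C = trans (weight-split (select S B C))
        (cong₂ _+_ (weight-select-inside S f₁ f₁-inside B C) (weight-select-outside S f₂ f₂-outside B C))

      minimal-inside : ∀ {B} → IsMinimal f B → IsMinimal f₁ B
      minimal-inside {B} (b , least) = b , λ B′ b′ → +-cancelʳ-≤ (weight f₂ B) _ _
        (subst₂ _≤_ (weight-split B) (weight-select B′ B) (least _ (separator-select {S} separator b′ b)))

      minimal-outside : ∀ {B} → IsMinimal f B → IsMinimal f₂ B
      minimal-outside {B} (b , least) = b , λ B′ b′ → +-cancelˡ-≤ (weight f₁ B) _ _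
        (subst₂ _≤_ (weight-split B) (weight-select B B′) (least _ (separator-select {S} separator b b′)))

      minimal-glue : ∀ {B C} → IsMinimal f₁ B → IsMinimal f₂ C → IsMinimal f (select S B C)
      minimal-glue {B} {C} (b , least₁) (c , least₂) = separator-select {S} separator b c , λ B′ b′ →
        subst₂ _≤_ (sym (weight-select B C)) (sym (weight-split B′)) (+-mono-≤ (least₁ B′ b′) (least₂ B′ b′))

    generic⇔minimaAgree : (MinimaAgreeOn S f₁ × MinimaAgreeOn (∁ S) f₂) ⇔ IsGeneric f
    generic⇔minimaAgree = mk⇔ glue split
      where
      glue : MinimaAgreeOn S f₁ × MinimaAgreeOn (∁ S) f₂ → IsGeneric f
      glue (agree₁ , agree₂) with minimal-exists f
      ... | B₀ , minB₀ = B₀ , minB₀ , λ C minC → lookup-extensionality (same C minC)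
        where
        same : ∀ C → IsMinimal f C → ∀ e → lookup C e ≡ lookup B₀ e
        same C minC e with lookup S e in e∈S
        ... | true  = agree₁ C B₀ (minimal-inside minC) (minimal-inside minB₀) e e∈S
        ... | false = agree₂ C B₀ (minimal-outside minC) (minimal-outside minB₀) e (trans (lookup-∁ S e) (cong not e∈S))
      split : IsGeneric f → MinimaAgreeOn S f₁ × MinimaAgreeOn (∁ S) f₂
      split (B₀ , minB₀ , only) = agree₁ , agree₂
        where
        agree₁ : MinimaAgreeOn S f₁
        agree₁ B C minB minC e e∈S = trans (along B minB) (sym (along C minC))
          where
          along : ∀ D → IsMinimal f₁ D → lookup D e ≡ lookup B₀ e
          along D minD = begin
            lookup D e                   ≡⟨ cong (λ c → if c then lookup D e else lookup B₀ e) e∈S ⟨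
            (if lookup S e then lookup D e else lookup B₀ e) ≡⟨ lookup-select S D B₀ e ⟨
            lookup (select S D B₀) e     ≡⟨ cong (λ X → lookup X e) (only _ (minimal-glue minD (minimal-outside minB₀))) ⟩
            lookup B₀ e                  ∎
            where open ≡-Reasoning
        agree₂ : MinimaAgreeOn (∁ S) f₂
        agree₂ B C minB minC e e∉S = trans (along B minB) (sym (along C minC))
          where
          S-e : lookup S e ≡ false
          S-e = trans (sym (Boolₚ.not-involutive (lookup S e))) (trans (cong not (sym (lookup-∁ S e))) (cong not e∉S))
          along : ∀ D → IsMinimal f₂ D → lookup D e ≡ lookup B₀ e
          along D minD = begin
            lookup D e                   ≡⟨ cong (λ c → if c then lookup B₀ e else lookup D e) S-e ⟨
            (if lookup S e then lookup B₀ e else lookup D e) ≡⟨ lookup-select S B₀ D e ⟨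
            lookup (select S B₀ D) e     ≡⟨ cong (λ X → lookup X e) (only _ (minimal-glue (minimal-inside minB₀) minD)) ⟩
            lookup B₀ e                  ∎
            where open ≡-Reasoning

    isGeneric-split : isGeneric M f ≡ genericOn S f₁ ∧ genericOn (∁ S) f₂
    isGeneric-split = det (isGeneric-reflects f)
      (proof (Dec.map generic⇔minimaAgree (minimaAgreeOn? S f₁ ×-dec minimaAgreeOn? (∁ S) f₂)))

dot : ∀ {n} → (Fin n → ℤ) → (Fin n → ℤ) → ℤ
dot φ p = sumFinℤ (λ e → φ e *ℤ p e)

dot-indicator : ∀ {n} (h : Fin n → ℕ) V → dot (λ e → pos (h e)) (indicator V) ≡ pos (weight h V)
dot-indicator h V = trans (sumFinℤ-cong term) (sumFinℤ-pos (λ e → if lookup V e then h e else 0))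
  where
  term : ∀ e → pos (h e) *ℤ indicator V e ≡ pos (if lookup V e then h e else 0)
  term e with lookup V e
  ... | true  = ℤₚ.*-identityʳ (pos (h e))
  ... | false = ℤₚ.*-zeroʳ (pos (h e))

dot-combination : ∀ {n k} (φ : Fin n → ℤ) (c : Fin k → ℤ) (p : Fin k → Fin n → ℤ) →
  dot φ (λ e → sumFinℤ (λ i → c i *ℤ p i e)) ≡ sumFinℤ (λ i → c i *ℤ dot φ (p i))
dot-combination φ c p = begin
  sumFinℤ (λ e → φ e *ℤ sumFinℤ (λ i → c i *ℤ p i e))  ≡⟨ sumFinℤ-cong (λ e → sumFinℤ-*ˡ (φ e) (λ i → c i *ℤ p i e)) ⟨
  sumFinℤ (λ e → sumFinℤ (λ i → φ e *ℤ (c i *ℤ p i e))) ≡⟨ sumFinℤ-comm (λ e i → φ e *ℤ (c i *ℤ p i e)) ⟩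
  sumFinℤ (λ i → sumFinℤ (λ e → φ e *ℤ (c i *ℤ p i e))) ≡⟨ sumFinℤ-cong (λ i → sumFinℤ-cong (λ e → swap (φ e) (c i) (p i e))) ⟩
  sumFinℤ (λ i → sumFinℤ (λ e → c i *ℤ (φ e *ℤ p i e))) ≡⟨ sumFinℤ-cong (λ i → sumFinℤ-*ˡ (c i) (λ e → φ e *ℤ p i e)) ⟩
  sumFinℤ (λ i → c i *ℤ dot φ (p i))                     ∎
  where
  open ≡-Reasoning
  swap : ∀ a b d → a *ℤ (b *ℤ d) ≡ b *ℤ (a *ℤ d)
  swap = CommSemigroupProperties.x∙yz≈y∙xz ℤₚ.*-commutativeSemigroup

-- Applying φ to a vanishing affine combination leaves a₀ · (dot φ (p zero) - c) = 0.
affinelyIndependent-extend : ∀ {n k} (p : Fin (suc (suc k)) → Fin n → ℤ) (φ : Fin n → ℤ) (c : ℤ) →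
  AffinelyIndependent (p ∘ suc) → (∀ i → dot φ (p (suc i)) ≡ c) → dot φ (p zero) ≢ c → AffinelyIndependent p
affinelyIndependent-extend {n} p φ c independent on-plane off-plane a Σa≡0 Σap≡0 = vanish
  where
  a₀ = a zero
  s = sumFinℤ (a ∘ suc)
  d₀ = dot φ (p zero)
  evaluated : a₀ *ℤ d₀ +ℤ s *ℤ c ≡ 0ℤ
  evaluated = begin
    a₀ *ℤ d₀ +ℤ s *ℤ c                                ≡⟨ cong (λ t → a₀ *ℤ d₀ +ℤ t) (trans (ℤₚ.*-comm s c) (sym (sumFinℤ-*ˡ c (a ∘ suc)))) ⟩
    a₀ *ℤ d₀ +ℤ sumFinℤ (λ i → c *ℤ a (suc i))        ≡⟨ cong (λ t → a₀ *ℤ d₀ +ℤ t) (sumFinℤ-cong λ i → trans (ℤₚ.*-comm c (a (suc i))) (cong (a (suc i) *ℤ_) (sym (on-plane i)))) ⟩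
    sumFinℤ (λ i → a i *ℤ dot φ (p i))               ≡⟨ dot-combination φ a p ⟨
    dot φ (λ e → sumFinℤ (λ i → a i *ℤ p i e))       ≡⟨ sumFinℤ-cong (λ e → trans (cong (φ e *ℤ_) (Σap≡0 e)) (ℤₚ.*-zeroʳ (φ e))) ⟩
    sumFinℤ {n} (λ _ → 0ℤ)                          ≡⟨ sumFinℤ-zero n ⟩
    0ℤ                                              ∎
    where open ≡-Reasoning
  a₀≡0 : a₀ ≡ 0ℤ
  a₀≡0 with ℤₚ.i*j≡0⇒i≡0∨j≡0 a₀ (trans (rearrange a₀ d₀ s c) (cong₂ (λ t u → t -ℤ u *ℤ c) evaluated Σa≡0))
    where
    rearrange : ∀ a₀ d₀ s c → a₀ *ℤ (d₀ -ℤ c) ≡ (a₀ *ℤ d₀ +ℤ s *ℤ c) -ℤ (a₀ +ℤ s) *ℤ c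
    rearrange = ℤ-Solver.solve-∀
  ... | inj₁ a₀≡0   = a₀≡0
  ... | inj₂ d₀-c≡0 = ⊥-elim (off-plane (ℤₚ.i-j≡0⇒i≡j d₀ c d₀-c≡0))
  s≡0 : s ≡ 0ℤ
  s≡0 = trans (sym (ℤₚ.+-identityˡ s)) (trans (cong (_+ℤ s) (sym a₀≡0)) Σa≡0)
  rest≡0 : ∀ e → sumFinℤ (λ i → a (suc i) *ℤ p (suc i) e) ≡ 0ℤ
  rest≡0 e = trans (sym (ℤₚ.+-identityˡ _)) (trans (cong (λ t → t *ℤ p zero e +ℤ sumFinℤ (λ i → a (suc i) *ℤ p (suc i) e)) (sym a₀≡0)) (Σap≡0 e))
  vanish : ∀ i → a i ≡ 0ℤ
  vanish zero    = a₀≡0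
  vanish (suc i) = independent (a ∘ suc) s≡0 rest≡0 i

-- V meets every class of label in as many elements as R does.
record Balanced {n r} (label : Fin n → Fin r) (R V : Subset n) : Set where
  constructor balanced
  field weights : ∀ (φ : Fin r → ℕ) → weight (φ ∘ label) V ≡ weight (φ ∘ label) R
open Balanced

balanced-refl : ∀ {n r} {label : Fin n → Fin r} {R} → Balanced label R R
balanced-refl = balanced λ _ → refl

balanced-coarsen : ∀ {n r s} {label : Fin n → Fin r} {R V} (g : Fin r → Fin s) → Balanced label R V → Balanced (g ∘ label) R V
balanced-coarsen g (balanced same) = balanced λ φ → same (φ ∘ g)

balanced-exch : ∀ {n r} {label : Fin n → Fin r} {R V x y} → Balanced label R V → label x ≡ label y →
  lookup V x ≡ true → lookup V y ≡ false → Balanced label R (exch V x y)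
balanced-exch {label = label} {R} {V} {x} {y} (balanced same) same-class x∈V y∉V = balanced λ φ →
  trans (+-cancelʳ-≡ (φ (label x)) _ _ (trans (weight-exch (φ ∘ label) {V} x∈V y∉V)
                                                (cong (λ ℓ → weight (φ ∘ label) V + φ ℓ) (sym same-class))))
        (same φ)

module _ {n} (M : Matroid n) where

  CrossingExchange : ∀ {r} → (Fin n → Fin r) → Subset n → Set
  CrossingExchange label B =
    ∃₂ λ x y → lookup B x ≡ true × lookup B y ≡ false × IsBase M (exch B x y) × label x ≢ label y

  crossingExchange? : ∀ {r} (label : Fin n → Fin r) B → Dec (CrossingExchange label B)
  crossingExchange? label B = Finₚ.any? λ x → Finₚ.any? λ y →
    (lookup B x Boolₚ.≟ true) ×-dec (lookup B y Boolₚ.≟ false) ×-dec isBase? M (exch B x y) ×-dec ¬? (label x Fin.≟ label y)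

  balanced-or-crossing : ∀ {r} {label : Fin n → Fin r} {R R′ B} → IsBase M R′ → Balanced label R R′ → IsBase M B →
    Balanced label R B ⊎ ∃ λ B′ → IsBase M B′ × Balanced label R B′ × CrossingExchange label B′
  balanced-or-crossing {label = label} {R} {B = B} r′ R′-balanced b = go r′ R′-balanced (<-wellFounded _)
    where
    go : ∀ {R′} → IsBase M R′ → Balanced label R R′ → Acc _<_ (diffSize R′ B) →
      Balanced label R B ⊎ ∃ λ B′ → IsBase M B′ × Balanced label R B′ × CrossingExchange label B′
    go {R′} r′ R′-balanced (acc rec) with difference-or-⊆ R′ B
    ... | inj₂ R′⊆B = inj₁ (subst (Balanced label R) (base-⊆⇒≡ M r′ b R′⊆B) R′-balanced)
    ... | inj₁ (x , x∈R′ , x∉B) with base-exchange M r′ b x∈R′ x∉B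
    ...   | y , y∈B , y∉R′ , r″ with label x Fin.≟ label y
    ...     | yes same  = go r″ (balanced-exch R′-balanced same x∈R′ y∉R′) (rec (diffSize-exch {A = R′} {B} x∈R′ y∉R′ x∉B y∈B))
    ...     | no differ = inj₂ (R′ , r′ , R′-balanced , x , y , x∈R′ , y∉R′ , r″ , differ)

  class : ∀ {r} → (Fin n → Fin r) → Fin r → Subset n
  class label ℓ = tabulate (λ e → does (label e Fin.≟ ℓ))

  class-separator : ∀ {r} (label : Fin n → Fin r) ℓ → (∀ B → IsBase M B → ¬ CrossingExchange label B) →
    IsSeparator M (class label ℓ)
  class-separator label ℓ no-crossing {B} {x} {y} b x∈B y∉B b′ = begin
    lookup (class label ℓ) x   ≡⟨ Vecₚ.lookup∘tabulate _ x ⟩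
    does (label x Fin.≟ ℓ)     ≡⟨ cong (λ c → does (c Fin.≟ ℓ)) same-class ⟩
    does (label y Fin.≟ ℓ)     ≡⟨ Vecₚ.lookup∘tabulate _ y ⟨
    lookup (class label ℓ) y   ∎
    where
    open ≡-Reasoning
    same-class = decidable-stable (label x Fin.≟ label y) (λ differ → no-crossing B b (x , y , x∈B , y∉B , b′ , differ))

merge : ∀ {r} (a b : Fin (suc (suc r))) → a ≢ b → Fin (suc (suc r)) → Fin (suc r)
merge a b a≢b ℓ with ℓ Fin.≟ a
... | yes _   = punchOut a≢b
... | no ℓ≢a = punchOut (ℓ≢a ∘ sym)

merge-identifies : ∀ {r} (a b : Fin (suc (suc r))) (a≢b : a ≢ b) → merge a b a≢b a ≡ merge a b a≢b b
merge-identifies a b a≢b with a Fin.≟ a | b Fin.≟ a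
... | no a≢a | _        = ⊥-elim (a≢a refl)
... | yes _  | yes refl = ⊥-elim (a≢b refl)
... | yes _  | no b≢a   = Finₚ.punchOut-cong a refl

merge-punchIn : ∀ {r} (a b : Fin (suc (suc r))) (a≢b : a ≢ b) ℓ → merge a b a≢b (punchIn a ℓ) ≡ ℓ
merge-punchIn a b a≢b ℓ with punchIn a ℓ Fin.≟ a
... | yes hit = ⊥-elim (Finₚ.punchInᵢ≢i a ℓ hit)
... | no _    = trans (Finₚ.punchOut-cong a refl) (Finₚ.punchOut-punchIn a)

module _ {m} (M : Matroid (suc m)) where

  NontrivialSeparator : Set
  NontrivialSeparator = ∃ λ S → IsSeparator M S × (∃ λ e → lookup S e ≡ true) × (∃ λ e → lookup S e ≡ false)

  record Configuration (r k : ℕ) : Set where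
    field
      label       : Fin (suc m) → Fin (suc r)
      label-onto  : ∀ ℓ → ∃ λ e → label e ≡ ℓ
      reference   : Subset (suc m)
      points      : Fin (suc k) → Subset (suc m)
      points-base : ∀ i → IsBase M (points i)
      points-independent : AffinelyIndependent (λ i → indicator (points i))
      points-balanced    : ∀ i → Balanced label reference (points i)

  initial : Configuration m 0
  initial = record
    { label = λ e → e ; label-onto = λ ℓ → ℓ , refl ; reference = R
    ; points = λ _ → R ; points-base = λ _ → proj₂ (nonempty M)
    ; points-independent = λ { c Σc≡0 _ zero → trans (sym (ℤₚ.+-identityʳ (c zero))) Σc≡0 }
    ; points-balanced = λ _ → balanced-refl }
    where R = proj₁ (nonempty M)

  -- The class of y meets B - x + y in one more element than it meets every earlier point.
  crossing-independent : ∀ {r k} (C : Configuration r k) → let open Configuration C in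
    ∀ {B x y} → Balanced label reference B → lookup B x ≡ true → lookup B y ≡ false → label x ≢ label y →
    AffinelyIndependent (λ i → indicator ((exch B x y Vector.∷ points) i))
  crossing-independent {r} C {B} {x} {y} balanced-B x∈B y∉B crossing =
    affinelyIndependent-extend (λ i → indicator ((exch B x y Vector.∷ points) i)) (λ e → pos (χ e)) (pos (weight χ reference))
      points-independent on-plane off-plane
    where
    open Configuration C
    χᶜ : Fin (suc r) → ℕ
    χᶜ ℓ = 𝟙 (does (ℓ Fin.≟ label y))
    χ : Fin (suc m) → ℕ
    χ = χᶜ ∘ label
    on-plane : ∀ i → dot (λ e → pos (χ e)) (indicator (points i)) ≡ pos (weight χ reference)
    on-plane i = trans (dot-indicator χ (points i)) (cong pos (weights (points-balanced i) χᶜ))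
    one-more : weight χ (exch B x y) ≡ suc (weight χ reference)
    one-more = begin
      weight χ (exch B x y)              ≡⟨ +-identityʳ _ ⟨
      weight χ (exch B x y) + 0          ≡⟨ cong (λ c → weight χ (exch B x y) + 𝟙 c) (dec-false (label x Fin.≟ label y) crossing) ⟨
      weight χ (exch B x y) + χ x        ≡⟨ weight-exch χ {B} x∈B y∉B ⟩
      weight χ B + χ y                   ≡⟨ cong (λ c → weight χ B + 𝟙 c) (dec-true (label y Fin.≟ label y) refl) ⟩
      weight χ B + 1                     ≡⟨ +-comm (weight χ B) 1 ⟩
      suc (weight χ B)                   ≡⟨ cong suc (weights balanced-B χᶜ) ⟩
      suc (weight χ reference)           ∎
      where open ≡-Reasoning
    off-plane : dot (λ e → pos (χ e)) (indicator (exch B x y)) ≢ pos (weight χ reference)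
    off-plane on = 1+n≢n (trans (sym one-more) (ℤₚ.+-injective (trans (sym (dot-indicator χ (exch B x y))) on)))

  coarsen : ∀ {r k} (C : Configuration (suc r) k) → let open Configuration C in
    ∀ {B} → IsBase M B → Balanced label reference B → CrossingExchange M label B → Configuration r (suc k)
  coarsen C {B} b balanced-B (x , y , x∈B , y∉B , b′ , crossing) = record
    { label              = squash ∘ label
    ; label-onto         = label′-onto
    ; reference          = reference
    ; points             = exch B x y Vector.∷ points
    ; points-base        = λ { zero → b′ ; (suc i) → points-base i }
    ; points-independent = crossing-independent C balanced-B x∈B y∉B crossing
    ; points-balanced    = λ { zero    → balanced-exch (balanced-coarsen squash balanced-B) (sym (merge-identifies _ _ y≢x)) x∈B y∉B
                             ; (suc i) → balanced-coarsen squash (points-balanced i) } }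
    where
    open Configuration C
    y≢x : label y ≢ label x
    y≢x = crossing ∘ sym
    squash = merge (label y) (label x) y≢x
    label′-onto : ∀ ℓ → ∃ λ e → squash (label e) ≡ ℓ
    label′-onto ℓ with label-onto (punchIn (label y) ℓ)
    ... | e , label-e = e , trans (cong squash label-e) (merge-punchIn (label y) (label x) y≢x ℓ)

  separator-or-coarsen : ∀ {r k} → Configuration (suc r) k → NontrivialSeparator ⊎ Configuration r (suc k)
  separator-or-coarsen C with anySubset? (λ B → isBase? M B ×-dec crossingExchange? M label B)
    where open Configuration C
  ... | yes (B , b , crossing) with balanced-or-crossing M (points-base zero) (points-balanced zero) b
    where open Configuration C
  ...   | inj₁ balanced-B = inj₂ (coarsen C b balanced-B crossing)
  ...   | inj₂ (B′ , b′ , balanced-B′ , crossing′) = inj₂ (coarsen C b′ balanced-B′ crossing′)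
  separator-or-coarsen C | no no-crossing =
    inj₁ (class M label zero , class-separator M label zero (λ B b crossing → no-crossing (B , b , crossing)) ,
          member zero , non-member)
    where
    open Configuration C
    member : ∀ ℓ → ∃ λ e → lookup (class M label zero) e ≡ does (ℓ Fin.≟ zero)
    member ℓ with label-onto ℓ
    ... | e , refl = e , Vecₚ.lookup∘tabulate (λ e → does (label e Fin.≟ zero)) e
    non-member = member (suc zero)

  refine : ∀ r k → r + k ≡ m → Configuration r k → ¬ DimAtLeast M m → NontrivialSeparator
  refine zero    k refl C low-dimension = ⊥-elim (low-dimension (points , points-base , points-independent))
    where open Configuration C
  refine (suc r) k r+k≡m C low-dimension with separator-or-coarsen C
  ... | inj₁ separator = separator
  ... | inj₂ C′        = refine r (suc k) (trans (+-suc r k) r+k≡m) C′ low-dimension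

  nontrivial-separator : ¬ DimAtLeast M m → NontrivialSeparator
  nontrivial-separator = refine m 0 (+-identityʳ m) initial

sumOver : ∀ {A : Set} → List A → (A → ℕ) → ℕ
sumOver []       f = 0
sumOver (x ∷ xs) f = f x + sumOver xs f

module _ {A : Set} where

  sumOver-cong : ∀ (xs : List A) {f g : A → ℕ} → (∀ x → f x ≡ g x) → sumOver xs f ≡ sumOver xs g
  sumOver-cong []       eq = refl
  sumOver-cong (x ∷ xs) eq = cong₂ _+_ (eq x) (sumOver-cong xs eq)

  sumOver-zero : ∀ (xs : List A) → sumOver xs (λ _ → 0) ≡ 0
  sumOver-zero []       = refl
  sumOver-zero (x ∷ xs) = sumOver-zero xs

  sumOver-+ : ∀ (xs : List A) (f g : A → ℕ) → sumOver xs (λ x → f x + g x) ≡ sumOver xs f + sumOver xs g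
  sumOver-+ []       f g = refl
  sumOver-+ (x ∷ xs) f g = trans (cong (f x + g x +_) (sumOver-+ xs f g)) (+-CS.interchange (f x) (g x) _ _)

  sumOver-*ˡ : ∀ (xs : List A) (c : ℕ) (f : A → ℕ) → sumOver xs (λ x → c * f x) ≡ c * sumOver xs f
  sumOver-*ˡ []       c f = sym (*-zeroʳ c)
  sumOver-*ˡ (x ∷ xs) c f = trans (cong (c * f x +_) (sumOver-*ˡ xs c f)) (sym (*-distribˡ-+ c (f x) _))

  sumOver-*ʳ : ∀ (xs : List A) (f : A → ℕ) (c : ℕ) → sumOver xs (λ x → f x * c) ≡ sumOver xs f * c
  sumOver-*ʳ xs f c = trans (sumOver-cong xs (λ x → *-comm (f x) c)) (trans (sumOver-*ˡ xs c f) (*-comm c _))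

  sumOver-++ : ∀ (xs ys : List A) (f : A → ℕ) → sumOver (xs ++ ys) f ≡ sumOver xs f + sumOver ys f
  sumOver-++ []       ys f = refl
  sumOver-++ (x ∷ xs) ys f = trans (cong (f x +_) (sumOver-++ xs ys f)) (sym (+-assoc (f x) _ _))

  sumOver-mono : ∀ (xs : List A) {f g : A → ℕ} → (∀ x → f x ≤ g x) → sumOver xs f ≤ sumOver xs g
  sumOver-mono []       le = z≤n
  sumOver-mono (x ∷ xs) le = +-mono-≤ (le x) (sumOver-mono xs le)

  countᵇ≡sumOver : ∀ (p : A → Bool) xs → countᵇ p xs ≡ sumOver xs (𝟙 ∘ p)
  countᵇ≡sumOver p []       = refl
  countᵇ≡sumOver p (x ∷ xs) = cong (𝟙 (p x) +_) (countᵇ≡sumOver p xs)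

module _ {A B : Set} where

  sumOver-map : ∀ (xs : List A) (g : A → B) (f : B → ℕ) → sumOver (map g xs) f ≡ sumOver xs (f ∘ g)
  sumOver-map []       g f = refl
  sumOver-map (x ∷ xs) g f = cong (f (g x) +_) (sumOver-map xs g f)

  sumOver-concatMap : ∀ (xs : List A) (g : A → List B) (f : B → ℕ) →
    sumOver (concatMap g xs) f ≡ sumOver xs (λ x → sumOver (g x) f)
  sumOver-concatMap []       g f = refl
  sumOver-concatMap (x ∷ xs) g f =
    trans (sumOver-++ (g x) (concatMap g xs) f) (cong (sumOver (g x) f +_) (sumOver-concatMap xs g f))

  sumOver-comm : ∀ (xs : List A) (ys : List B) (f : A → B → ℕ) →
    sumOver xs (λ x → sumOver ys (f x)) ≡ sumOver ys (λ y → sumOver xs (λ x → f x y))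
  sumOver-comm []       ys f = sym (sumOver-zero ys)
  sumOver-comm (x ∷ xs) ys f =
    trans (cong (sumOver ys (f x) +_) (sumOver-comm xs ys f)) (sym (sumOver-+ ys (f x) (λ y → sumOver xs (λ x′ → f x′ y))))

module _ {A : Set} where

  countᵇ-cong : ∀ {p q : A → Bool} xs → (∀ x → p x ≡ q x) → countᵇ p xs ≡ countᵇ q xs
  countᵇ-cong []       eq = refl
  countᵇ-cong (x ∷ xs) eq = cong₂ _+_ (cong 𝟙 (eq x)) (countᵇ-cong xs eq)

  countᵇ-if : ∀ (c p q : A → Bool) xs →
    countᵇ (λ x → if c x then p x else q x) xs ≡ countᵇ (λ x → c x ∧ p x) xs + countᵇ (λ x → not (c x) ∧ q x) xs
  countᵇ-if c p q []       = refl
  countᵇ-if c p q (x ∷ xs) with c x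
  ... | true  = trans (cong (𝟙 (p x) +_) (countᵇ-if c p q xs)) (sym (+-assoc (𝟙 (p x)) _ _))
  ... | false = trans (cong (𝟙 (q x) +_) (countᵇ-if c p q xs))
                      (+-CS.x∙yz≈y∙xz (𝟙 (q x)) (countᵇ (λ x → c x ∧ p x) xs) (countᵇ (λ x → not (c x) ∧ q x) xs))

  zipWith-+-map : ∀ (f g : A → ℕ) xs → zipWith _+_ (map f xs) (map g xs) ≡ map (λ x → f x + g x) xs
  zipWith-+-map f g []       = refl
  zipWith-+-map f g (x ∷ xs) = cong (f x + g x ∷_) (zipWith-+-map f g xs)

countᵇ-map : ∀ {A B : Set} (p : B → Bool) (f : A → B) xs → countᵇ p (map f xs) ≡ countᵇ (p ∘ f) xs
countᵇ-map p f []       = refl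
countᵇ-map p f (x ∷ xs) = cong (𝟙 (p (f x)) +_) (countᵇ-map p f xs)

sumOver-const-1 : ∀ {A : Set} (xs : List A) → sumOver xs (λ _ → 1) ≡ length xs
sumOver-const-1 []       = refl
sumOver-const-1 (x ∷ xs) = cong suc (sumOver-const-1 xs)

expSum-map : ∀ {A : Set} (f : A → ℕ) xs → expSum (map f xs) ≡ sumOver xs f
expSum-map f []       = refl
expSum-map f (x ∷ xs) = cong (f x +_) (expSum-map f xs)

listEqᵇ⇒≡ : ∀ (xs ys : List ℕ) → T (listEqᵇ xs ys) → xs ≡ ys
listEqᵇ⇒≡ []       []       _  = refl
listEqᵇ⇒≡ (x ∷ xs) (y ∷ ys) eq with Boolₚ.T-∧ .Equivalence.to eq
... | x≡y , xs≡ys = cong₂ _∷_ (≡ᵇ⇒≡ x y x≡y) (listEqᵇ⇒≡ xs ys xs≡ys)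

sumOver-allFinL : ∀ {k} (f : Fin k → ℕ) → sumOver (allFinL k) f ≡ sumFinℕ f
sumOver-allFinL {zero}  f = refl
sumOver-allFinL {suc k} f = cong (f zero +_) (trans (sumOver-map (allFinL k) suc f) (sumOver-allFinL (f ∘ suc)))

length-allFinL : ∀ k → length (allFinL k) ≡ k
length-allFinL zero    = refl
length-allFinL (suc k) = cong suc (trans (Listₚ.length-map suc (allFinL k)) (length-allFinL k))

sumFin-indicator : ∀ b h (G : ℕ → ℕ) → sumFinℕ {suc b} (λ c → 𝟙 (h ≡ᵇ toℕ c) * G (toℕ c)) ≡ (if h ≤ᵇ b then G h else 0)
sumFin-indicator zero    zero    G = trans (+-identityʳ _) (+-identityʳ (G 0))
sumFin-indicator zero    (suc h) G = refl
sumFin-indicator (suc b) zero    G =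
  trans (cong₂ _+_ (+-identityʳ (G 0)) (sumFinℕ-zero (suc b))) (+-identityʳ (G 0))
sumFin-indicator (suc b) (suc h) G = trans (sumFin-indicator b h (G ∘ suc)) (cong (λ t → if t then G (suc h) else 0) (sym (suc≤ᵇsuc h b)))
  where
  suc≤ᵇsuc : ∀ h b → (suc h ≤ᵇ suc b) ≡ (h ≤ᵇ b)
  suc≤ᵇsuc zero    b = refl
  suc≤ᵇsuc (suc h) b = refl

sumFin-convolution : ∀ b h₁ h₂ → sumFinℕ {suc b} (λ c → 𝟙 (h₁ ≡ᵇ toℕ c) * 𝟙 (h₂ ≡ᵇ b ∸ toℕ c)) ≡ 𝟙 (h₁ + h₂ ≡ᵇ b)
sumFin-convolution b h₁ h₂ = trans (sumFin-indicator b h₁ (λ t → 𝟙 (h₂ ≡ᵇ b ∸ t))) (cases (h₁ ≤? b))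
  where
  cases : Dec (h₁ ≤ b) → (if h₁ ≤ᵇ b then 𝟙 (h₂ ≡ᵇ b ∸ h₁) else 0) ≡ 𝟙 (h₁ + h₂ ≡ᵇ b)
  cases (yes h₁≤b) rewrite Boolₚ.T-≡ .Equivalence.to (≤⇒≤ᵇ h₁≤b) =
    cong 𝟙 (det (proof (h₂ ≟ b ∸ h₁)) (proof (Dec.map (mk⇔ to from) (h₁ + h₂ ≟ b))))
    where
    to : h₁ + h₂ ≡ b → h₂ ≡ b ∸ h₁
    to refl = sym (m+n∸m≡n h₁ h₂)
    from : h₂ ≡ b ∸ h₁ → h₁ + h₂ ≡ b
    from refl = m+[n∸m]≡n h₁≤b
  cases (no h₁≰b) with h₁ ≤ᵇ b in le | h₁ + h₂ ≡ᵇ b in eq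
  ... | true  | _     = ⊥-elim (h₁≰b (≤ᵇ⇒≤ h₁ b (subst T (sym le) _)))
  ... | false | false = refl
  ... | false | true  = ⊥-elim (h₁≰b (subst (h₁ ≤_) (≡ᵇ⇒≡ _ _ (subst T (sym eq) _)) (m≤m+n h₁ h₂)))

-- Only exponent lists of one length l are described, as F(M) at β counts maps into {1, …, length β}.
record Counts {A : Set} (l : ℕ) (g : Series) (xs : List A) (a : A → ℕ) (E : A → List ℕ) : Set where
  field
    exponent-length : ∀ x → length (E x) ≡ l
    coefficient     : ∀ γ → length γ ≡ l → g γ ≡ pos (sumOver xs (λ x → a x * 𝟙 (listEqᵇ (E x) γ)))
open Counts

headℕ : List ℕ → ℕ
headℕ []      = 0
headℕ (x ∷ _) = x

tailℕ : List ℕ → List ℕ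
tailℕ []       = []
tailℕ (_ ∷ xs) = xs

uncons : ∀ {l} (xs : List ℕ) → length xs ≡ suc l → xs ≡ headℕ xs ∷ tailℕ xs
uncons (x ∷ xs) _ = refl

length≡0 : ∀ (xs : List ℕ) → length xs ≡ 0 → xs ≡ []
length≡0 [] _ = refl

Counts-tail : ∀ {A l g xs a E} → Counts {A} (suc l) g xs a E → ∀ c →
  Counts l (λ γ → g (c ∷ γ)) xs (λ x → a x * 𝟙 (headℕ (E x) ≡ᵇ c)) (tailℕ ∘ E)
Counts-tail {l = l} {g} {xs} {a} {E} counts c = record
  { exponent-length = λ x → suc-injective (trans (cong length (sym (uncons (E x) (exponent-length counts x)))) (exponent-length counts x))
  ; coefficient     = λ γ len → trans (coefficient counts (c ∷ γ) (cong suc len)) (cong pos (sumOver-cong xs (split γ))) }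
  where
  split : ∀ γ x → a x * 𝟙 (listEqᵇ (E x) (c ∷ γ)) ≡ a x * 𝟙 (headℕ (E x) ≡ᵇ c) * 𝟙 (listEqᵇ (tailℕ (E x)) γ)
  split γ x = begin
    a x * 𝟙 (listEqᵇ (E x) (c ∷ γ))                              ≡⟨ cong (λ e → a x * 𝟙 (listEqᵇ e (c ∷ γ))) (uncons (E x) (exponent-length counts x)) ⟩
    a x * 𝟙 ((headℕ (E x) ≡ᵇ c) ∧ listEqᵇ (tailℕ (E x)) γ)     ≡⟨ cong (a x *_) (𝟙-∧ (headℕ (E x) ≡ᵇ c) _) ⟩
    a x * (𝟙 (headℕ (E x) ≡ᵇ c) * 𝟙 (listEqᵇ (tailℕ (E x)) γ)) ≡⟨ *-assoc (a x) _ _ ⟨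
    a x * 𝟙 (headℕ (E x) ≡ᵇ c) * 𝟙 (listEqᵇ (tailℕ (E x)) γ)   ∎
    where open ≡-Reasoning

sumFin-first-exponent : ∀ c₀ β {l} (u v : List ℕ) → length u ≡ suc l → length v ≡ suc l → ∀ p q →
  sumFinℕ {suc c₀} (λ c → p * 𝟙 (headℕ u ≡ᵇ toℕ c) * (q * 𝟙 (headℕ v ≡ᵇ c₀ ∸ toℕ c)) * 𝟙 (listEqᵇ (zipWith _+_ (tailℕ u) (tailℕ v)) β))
  ≡ p * q * 𝟙 (listEqᵇ (zipWith _+_ u v) (c₀ ∷ β))
sumFin-first-exponent c₀ β u v ∣u∣ ∣v∣ p q = begin
  sumFinℕ {suc c₀} (λ c → p * δu c * (q * δv c) * rest)
    ≡⟨ sumFinℕ-cong {suc c₀} (λ c → regroup p q rest (δu c) (δv c)) ⟩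
  sumFinℕ {suc c₀} (λ c → p * q * rest * (δu c * δv c))
    ≡⟨ sumFinℕ-*ˡ {suc c₀} (p * q * rest) (λ c → δu c * δv c) ⟩
  p * q * rest * sumFinℕ {suc c₀} (λ c → δu c * δv c)
    ≡⟨ cong (p * q * rest *_) (sumFin-convolution c₀ (headℕ u) (headℕ v)) ⟩
  p * q * rest * 𝟙 (headℕ u + headℕ v ≡ᵇ c₀)
    ≡⟨ *-CS.xy∙z≈x∙zy (p * q) rest (𝟙 (headℕ u + headℕ v ≡ᵇ c₀)) ⟩
  p * q * (𝟙 (headℕ u + headℕ v ≡ᵇ c₀) * rest)
    ≡⟨ cong (p * q *_) (𝟙-∧ (headℕ u + headℕ v ≡ᵇ c₀) (listEqᵇ (zipWith _+_ (tailℕ u) (tailℕ v)) β)) ⟨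
  p * q * 𝟙 (listEqᵇ ((headℕ u + headℕ v) ∷ zipWith _+_ (tailℕ u) (tailℕ v)) (c₀ ∷ β))
    ≡⟨ cong (λ w → p * q * 𝟙 (listEqᵇ w (c₀ ∷ β))) (cong₂ (zipWith _+_) (uncons u ∣u∣) (uncons v ∣v∣)) ⟨
  p * q * 𝟙 (listEqᵇ (zipWith _+_ u v) (c₀ ∷ β)) ∎
  where
  open ≡-Reasoning
  δu δv : Fin (suc c₀) → ℕ
  δu c = 𝟙 (headℕ u ≡ᵇ toℕ c)
  δv c = 𝟙 (headℕ v ≡ᵇ c₀ ∸ toℕ c)
  rest = 𝟙 (listEqᵇ (zipWith _+_ (tailℕ u) (tailℕ v)) β)
  regroup : ∀ p q r s t → p * s * (q * t) * r ≡ p * q * r * (s * t)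
  regroup = ℕ-Solver.solve-∀

mul-Counts : ∀ β {A B} {g h : Series} {xs : List A} {ys : List B} {a b E F} →
  Counts (length β) g xs a E → Counts (length β) h ys b F →
  mul g h β ≡ pos (sumOver xs λ x → sumOver ys λ y → a x * b y * 𝟙 (listEqᵇ (zipWith _+_ (E x) (F y)) β))
mul-Counts [] {g = g} {h} {xs} {ys} {a} {b} {E} {F} counts-g counts-h = begin
  g [] *ℤ h []                              ≡⟨ cong₂ _*ℤ_ (coefficient counts-g [] refl) (coefficient counts-h [] refl) ⟩
  pos (Σx) *ℤ pos (Σy)                      ≡⟨ ℤₚ.pos-* Σx Σy ⟨
  pos (Σx * Σy)                             ≡⟨ cong pos (sumOver-*ʳ xs (λ x → a x * 𝟙 (listEqᵇ (E x) [])) Σy) ⟨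
  pos (sumOver xs λ x → a x * 𝟙 (listEqᵇ (E x) []) * Σy)
                                            ≡⟨ cong pos (sumOver-cong xs λ x → sumOver-*ˡ ys (a x * 𝟙 (listEqᵇ (E x) [])) (λ y → b y * 𝟙 (listEqᵇ (F y) []))) ⟨
  pos (sumOver xs λ x → sumOver ys λ y → a x * 𝟙 (listEqᵇ (E x) []) * (b y * 𝟙 (listEqᵇ (F y) [])))
                                            ≡⟨ cong pos (sumOver-cong xs λ x → sumOver-cong ys λ y → empty x y) ⟩
  pos (sumOver xs λ x → sumOver ys λ y → a x * b y * 𝟙 (listEqᵇ (zipWith _+_ (E x) (F y)) [])) ∎
  where
  open ≡-Reasoning
  Σx = sumOver xs (λ x → a x * 𝟙 (listEqᵇ (E x) []))
  Σy = sumOver ys (λ y → b y * 𝟙 (listEqᵇ (F y) []))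
  empty : ∀ x y → a x * 𝟙 (listEqᵇ (E x) []) * (b y * 𝟙 (listEqᵇ (F y) [])) ≡ a x * b y * 𝟙 (listEqᵇ (zipWith _+_ (E x) (F y)) [])
  empty x y rewrite length≡0 (E x) (exponent-length counts-g x) | length≡0 (F y) (exponent-length counts-h y) =
    trans (cong₂ _*_ (*-identityʳ (a x)) (*-identityʳ (b y))) (sym (*-identityʳ (a x * b y)))
mul-Counts (c₀ ∷ β) {g = g} {h} {xs} {ys} {a} {b} {E} {F} counts-g counts-h = begin
  sumFinℤ {suc c₀} (λ c → mul (λ γ → g (toℕ c ∷ γ)) (λ δ → h ((c₀ ∸ toℕ c) ∷ δ)) β)
    ≡⟨ sumFinℤ-cong {suc c₀} (λ c → mul-Counts β (Counts-tail counts-g (toℕ c)) (Counts-tail counts-h (c₀ ∸ toℕ c))) ⟩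
  sumFinℤ {suc c₀} (λ c → pos (sumOver xs λ x → sumOver ys λ y → summand c x y))
    ≡⟨ sumFinℤ-pos (λ c → sumOver xs λ x → sumOver ys λ y → summand c x y) ⟩
  pos (sumFinℕ {suc c₀} λ c → sumOver xs λ x → sumOver ys λ y → summand c x y)
    ≡⟨ cong pos (sumOver-allFinL (λ c → sumOver xs λ x → sumOver ys λ y → summand c x y)) ⟨
  pos (sumOver (allFinL (suc c₀)) λ c → sumOver xs λ x → sumOver ys λ y → summand c x y)
    ≡⟨ cong pos (sumOver-comm (allFinL (suc c₀)) xs (λ c x → sumOver ys λ y → summand c x y)) ⟩
  pos (sumOver xs λ x → sumOver (allFinL (suc c₀)) λ c → sumOver ys λ y → summand c x y)
    ≡⟨ cong pos (sumOver-cong xs λ x → sumOver-comm (allFinL (suc c₀)) ys (λ c y → summand c x y)) ⟩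
  pos (sumOver xs λ x → sumOver ys λ y → sumOver (allFinL (suc c₀)) λ c → summand c x y)
    ≡⟨ cong pos (sumOver-cong xs λ x → sumOver-cong ys λ y → trans (sumOver-allFinL (λ c → summand c x y))
         (sumFin-first-exponent c₀ β (E x) (F y) (exponent-length counts-g x) (exponent-length counts-h y) (a x) (b y))) ⟩
  pos (sumOver xs λ x → sumOver ys λ y → a x * b y * 𝟙 (listEqᵇ (zipWith _+_ (E x) (F y)) (c₀ ∷ β))) ∎
  where
  open ≡-Reasoning
  summand : Fin (suc c₀) → _ → _ → ℕ
  summand c x y = a x * 𝟙 (headℕ (E x) ≡ᵇ toℕ c) * (b y * 𝟙 (headℕ (F y) ≡ᵇ c₀ ∸ toℕ c))
                * 𝟙 (listEqᵇ (zipWith _+_ (tailℕ (E x)) (tailℕ (F y))) β)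

value : ∀ {k} → Maybe (Fin k) → ℕ
value nothing  = 0
value (just i) = suc (toℕ i)

hits : ∀ {k} → Maybe (Fin k) → Fin k → Bool
hits nothing  j = false
hits (just i) j = toℕ i ≡ᵇ toℕ j

-- The maps T → Fin k, as vectors which are nothing outside T.
partialFuns : ∀ {n} → Subset n → (k : ℕ) → List (Vec (Maybe (Fin k)) n)
partialFuns []            k = [] ∷ []
partialFuns (inside ∷ T)  k = concatMap (λ v → map (λ i → just i ∷ v) (allFinL k)) (partialFuns T k)
partialFuns (outside ∷ T) k = map (nothing ∷_) (partialFuns T k)

masked : ∀ {k} → Bool → Maybe (Fin k) → ℕ
masked s x = if s then value x else 0

restrict : ∀ {n k} → Subset n → Vec (Maybe (Fin k)) n → Fin n → ℕ
restrict T v e = masked (lookup T e) (lookup v e)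

multiplicity : ∀ {n k} → Subset n → Vec (Maybe (Fin k)) n → Fin k → ℕ
multiplicity {n} T v j = countᵇ (λ e → lookup T e ∧ hits (lookup v e) j) (allFinL n)

exponent : ∀ {n k} → Subset n → Vec (Maybe (Fin k)) n → List ℕ
exponent {k = k} T v = map (multiplicity T v) (allFinL k)

contributes : ∀ {n k} → Matroid n → Subset n → List ℕ → Vec (Maybe (Fin k)) n → Bool
contributes M T β v = genericOn M T (restrict T v) ∧ listEqᵇ (exponent T v) β

-- F(M | T) for a separator T, without constructing the restricted matroid.
FM-on : ∀ {n} → Matroid n → Subset n → Series
FM-on M T β = pos (countᵇ (contributes M T β) (partialFuns T (length β)))

sumOver-allFuns-suc : ∀ {n k} (G : Vec (Maybe (Fin k)) (suc n) → ℕ) →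
  sumOver (allFuns (suc n) k) (G ∘ Vec.map just) ≡ sumOver (allFuns n k) (λ v → sumOver (allFinL k) λ i → G (just i ∷ Vec.map just v))
sumOver-allFuns-suc {n} {k} G =
  trans (sumOver-concatMap (allFuns n k) (λ v → map (_∷ v) (allFinL k)) (G ∘ Vec.map just))
        (sumOver-cong (allFuns n k) λ v → sumOver-map (allFinL k) (_∷ v) (G ∘ Vec.map just))

sumOver-partialFuns-inside : ∀ {n k} (T : Subset n) (F : Vec (Maybe (Fin k)) (suc n) → ℕ) →
  sumOver (partialFuns (inside ∷ T) k) F ≡ sumOver (partialFuns T k) (λ v → sumOver (allFinL k) λ i → F (just i ∷ v))
sumOver-partialFuns-inside {k = k} T F =
  trans (sumOver-concatMap (partialFuns T k) (λ v → map (λ i → just i ∷ v) (allFinL k)) F)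
        (sumOver-cong (partialFuns T k) λ v → sumOver-map (allFinL k) (λ i → just i ∷ v) F)

sumOver-partialFuns-outside : ∀ {n k} (T : Subset n) (F : Vec (Maybe (Fin k)) (suc n) → ℕ) →
  sumOver (partialFuns (outside ∷ T) k) F ≡ sumOver (partialFuns T k) (λ v → F (nothing ∷ v))
sumOver-partialFuns-outside {k = k} T F = sumOver-map (partialFuns T k) (nothing ∷_) F

sumOver-allFuns-split : ∀ {n k} (S : Subset n) (G : Vec (Maybe (Fin k)) n → ℕ) →
  sumOver (allFuns n k) (G ∘ Vec.map just) ≡
  sumOver (partialFuns S k) λ u → sumOver (partialFuns (∁ S) k) λ w → G (select S u w)
sumOver-allFuns-split []            G = sym (+-identityʳ (G [] + 0))
sumOver-allFuns-split {suc n} {k} (inside ∷ S) G = begin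
  sumOver (allFuns (suc n) k) (G ∘ Vec.map just)
    ≡⟨ sumOver-allFuns-suc G ⟩
  sumOver (allFuns n k) (λ v → sumOver (allFinL k) λ i → G (just i ∷ Vec.map just v))
    ≡⟨ sumOver-allFuns-split S (λ v → sumOver (allFinL k) λ i → G (just i ∷ v)) ⟩
  sumOver (partialFuns S k) (λ u → sumOver (partialFuns (∁ S) k) λ w → sumOver (allFinL k) λ i → G (just i ∷ select S u w))
    ≡⟨ sumOver-cong (partialFuns S k) (λ u → sumOver-comm (partialFuns (∁ S) k) (allFinL k) λ w i → G (just i ∷ select S u w)) ⟩
  sumOver (partialFuns S k) (λ u → sumOver (allFinL k) λ i → sumOver (partialFuns (∁ S) k) λ w → G (just i ∷ select S u w))
    ≡⟨ sumOver-cong (partialFuns S k) (λ u → sumOver-cong (allFinL k) λ i →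
         sumOver-partialFuns-outside (∁ S) (λ w → G (select (inside ∷ S) (just i ∷ u) w))) ⟨
  sumOver (partialFuns S k) (λ u → sumOver (allFinL k) λ i → sumOver (partialFuns (∁ (inside ∷ S)) k) λ w → G (select (inside ∷ S) (just i ∷ u) w))
    ≡⟨ sumOver-partialFuns-inside S (λ u → sumOver (partialFuns (∁ (inside ∷ S)) k) λ w → G (select (inside ∷ S) u w)) ⟨
  sumOver (partialFuns (inside ∷ S) k) (λ u → sumOver (partialFuns (∁ (inside ∷ S)) k) λ w → G (select (inside ∷ S) u w)) ∎
  where open ≡-Reasoning
sumOver-allFuns-split {suc n} {k} (outside ∷ S) G = begin
  sumOver (allFuns (suc n) k) (G ∘ Vec.map just)
    ≡⟨ sumOver-allFuns-suc G ⟩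
  sumOver (allFuns n k) (λ v → sumOver (allFinL k) λ i → G (just i ∷ Vec.map just v))
    ≡⟨ sumOver-allFuns-split S (λ v → sumOver (allFinL k) λ i → G (just i ∷ v)) ⟩
  sumOver (partialFuns S k) (λ u → sumOver (partialFuns (∁ S) k) λ w → sumOver (allFinL k) λ i → G (just i ∷ select S u w))
    ≡⟨ sumOver-cong (partialFuns S k) (λ u → sumOver-partialFuns-inside (∁ S) (λ w → G (select (outside ∷ S) (nothing ∷ u) w))) ⟨
  sumOver (partialFuns S k) (λ u → sumOver (partialFuns (∁ (outside ∷ S)) k) λ w → G (select (outside ∷ S) (nothing ∷ u) w))
    ≡⟨ sumOver-partialFuns-outside S (λ u → sumOver (partialFuns (∁ (outside ∷ S)) k) λ w → G (select (outside ∷ S) u w)) ⟨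
  sumOver (partialFuns (outside ∷ S) k) (λ u → sumOver (partialFuns (∁ (outside ∷ S)) k) λ w → G (select (outside ∷ S) u w)) ∎
  where open ≡-Reasoning

fullExponent : ∀ {n k} → Vec (Maybe (Fin k)) n → List ℕ
fullExponent {n} {k} w = map (λ j → countᵇ (λ e → hits (lookup w e) j) (allFinL n)) (allFinL k)

module _ {n} (M : Matroid n) where

  FM-as-sum : ∀ β → FM M β ≡
    pos (sumOver (allFuns n (length β)) λ v → 𝟙 (isGeneric M (value ∘ lookup (Vec.map just v)) ∧ listEqᵇ (fullExponent (Vec.map just v)) β))
  FM-as-sum β = cong pos (trans (countᵇ≡sumOver _ (allFuns n (length β))) (sumOver-cong (allFuns n (length β)) λ v →
    cong 𝟙 (cong₂ (λ g e → g ∧ listEqᵇ e β)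
      (isGeneric-transfer M {λ e → suc (toℕ (lookup v e))} {value ∘ lookup (Vec.map just v)}
        (subst₂ _≤_ (as-value v _) (as-value v _)) (subst₂ _≤_ (sym (as-value v _)) (sym (as-value v _))))
      (Listₚ.map-cong (λ j → countᵇ-cong (allFinL n) λ e → cong (λ x → hits x j) (sym (Vecₚ.lookup-map e just v))) (allFinL (length β))))))
    where
    as-value : ∀ {k} (v : Vec (Fin k) n) e → suc (toℕ (lookup v e)) ≡ value (lookup (Vec.map just v) e)
    as-value v e = cong value (sym (Vecₚ.lookup-map e just v))

  FM-on-Counts : ∀ T (β : List ℕ) → Counts (length β) (FM-on M T) (partialFuns T (length β)) (λ v → 𝟙 (genericOn M T (restrict T v))) (exponent T)
  FM-on-Counts T β = record
    { exponent-length = λ v → trans (Listₚ.length-map (multiplicity T v) (allFinL (length β))) (length-allFinL (length β))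
    ; coefficient = λ γ len → trans (cong (λ K → pos (countᵇ (contributes {k = K} M T γ) (partialFuns T K))) len)
        (cong pos (trans (countᵇ≡sumOver (contributes M T γ) (partialFuns T (length β)))
                         (sumOver-cong (partialFuns T (length β)) λ v → 𝟙-∧ (genericOn M T (restrict T v)) _))) }

  module _ {S} (separator : IsSeparator M S) {k} (u w : Vec (Maybe (Fin k)) n) where

    value-select : ∀ e → value (lookup (select S u w) e) ≡ restrict S u e + restrict (∁ S) w e
    value-select e rewrite lookup-select S u w e | lookup-∁ S e with lookup S e
    ... | true  = sym (+-identityʳ _)
    ... | false = refl

    isGeneric-select : isGeneric M (value ∘ lookup (select S u w)) ≡ genericOn M S (restrict S u) ∧ genericOn M (∁ S) (restrict (∁ S) w)
    isGeneric-select = trans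
      (isGeneric-transfer M {value ∘ lookup (select S u w)} {λ e → restrict S u e + restrict (∁ S) w e}
        (subst₂ _≤_ (value-select _) (value-select _)) (subst₂ _≤_ (sym (value-select _)) (sym (value-select _))))
      (isGeneric-split M {S} separator (restrict S u) (restrict (∁ S) w) inside-only outside-only)
      where
      inside-only : ∀ e → lookup S e ≡ false → restrict S u e ≡ 0
      inside-only e e∉S = cong (λ c → if c then value (lookup u e) else 0) e∉S
      outside-only : ∀ e → lookup S e ≡ true → restrict (∁ S) w e ≡ 0
      outside-only e e∈S = cong (λ c → if c then value (lookup w e) else 0) (trans (lookup-∁ S e) (cong not e∈S))

    fullExponent-select : fullExponent (select S u w) ≡ zipWith _+_ (exponent S u) (exponent (∁ S) w)
    fullExponent-select = trans (Listₚ.map-cong split (allFinL k)) (sym (zipWith-+-map (multiplicity S u) (multiplicity (∁ S) w) (allFinL k)))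
      where
      hits-select : ∀ j e → hits (lookup (select S u w) e) j ≡ (if lookup S e then hits (lookup u e) j else hits (lookup w e) j)
      hits-select j e rewrite lookup-select S u w e with lookup S e
      ... | true  = refl
      ... | false = refl
      split : ∀ j → countᵇ (λ e → hits (lookup (select S u w) e) j) (allFinL n) ≡ multiplicity S u j + multiplicity (∁ S) w j
      split j = begin
        countᵇ (λ e → hits (lookup (select S u w) e) j) (allFinL n)
          ≡⟨ countᵇ-cong (allFinL n) (hits-select j) ⟩
        countᵇ (λ e → if lookup S e then hits (lookup u e) j else hits (lookup w e) j) (allFinL n)
          ≡⟨ countᵇ-if (lookup S) (λ e → hits (lookup u e) j) (λ e → hits (lookup w e) j) (allFinL n) ⟩
        multiplicity S u j + countᵇ (λ e → not (lookup S e) ∧ hits (lookup w e) j) (allFinL n)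
          ≡⟨ cong (multiplicity S u j +_) (countᵇ-cong (allFinL n) λ e → cong (_∧ hits (lookup w e) j) (sym (lookup-∁ S e))) ⟩
        multiplicity S u j + multiplicity (∁ S) w j ∎
        where open ≡-Reasoning

  FM-factorizes : ∀ {S} → IsSeparator M S → ∀ β → FM M β ≡ mul (FM-on M S) (FM-on M (∁ S)) β
  FM-factorizes {S} separator β = begin
    FM M β
      ≡⟨ FM-as-sum β ⟩
    pos (sumOver (allFuns n K) (G ∘ Vec.map just))
      ≡⟨ cong pos (sumOver-allFuns-split S G) ⟩
    pos (sumOver (partialFuns S K) λ u → sumOver (partialFuns (∁ S) K) λ w → G (select S u w))
      ≡⟨ cong pos (sumOver-cong (partialFuns S K) λ u → sumOver-cong (partialFuns (∁ S) K) λ w → factor u w) ⟩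
    pos (sumOver (partialFuns S K) λ u → sumOver (partialFuns (∁ S) K) λ w →
           𝟙 (genericOn M S (restrict S u)) * 𝟙 (genericOn M (∁ S) (restrict (∁ S) w)) * 𝟙 (listEqᵇ (zipWith _+_ (exponent S u) (exponent (∁ S) w)) β))
      ≡⟨ mul-Counts β (FM-on-Counts S β) (FM-on-Counts (∁ S) β) ⟨
    mul (FM-on M S) (FM-on M (∁ S)) β ∎
    where
    open ≡-Reasoning
    K = length β
    G : Vec (Maybe (Fin K)) n → ℕ
    G v = 𝟙 (isGeneric M (value ∘ lookup v) ∧ listEqᵇ (fullExponent v) β)
    factor : ∀ u w → G (select S u w) ≡
      𝟙 (genericOn M S (restrict S u)) * 𝟙 (genericOn M (∁ S) (restrict (∁ S) w)) * 𝟙 (listEqᵇ (zipWith _+_ (exponent S u) (exponent (∁ S) w)) β)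
    factor u w = begin
      G (select S u w)
        ≡⟨ cong₂ (λ g e → 𝟙 (g ∧ listEqᵇ e β)) (isGeneric-select {S} separator u w) (fullExponent-select {S} separator u w) ⟩
      𝟙 ((genericOn M S (restrict S u) ∧ genericOn M (∁ S) (restrict (∁ S) w)) ∧ listEqᵇ (zipWith _+_ (exponent S u) (exponent (∁ S) w)) β)
        ≡⟨ 𝟙-∧ (genericOn M S (restrict S u) ∧ genericOn M (∁ S) (restrict (∁ S) w)) _ ⟩
      𝟙 (genericOn M S (restrict S u) ∧ genericOn M (∁ S) (restrict (∁ S) w)) * 𝟙 (listEqᵇ (zipWith _+_ (exponent S u) (exponent (∁ S) w)) β)
        ≡⟨ cong (_* 𝟙 (listEqᵇ (zipWith _+_ (exponent S u) (exponent (∁ S) w)) β)) (𝟙-∧ (genericOn M S (restrict S u)) _) ⟩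
      𝟙 (genericOn M S (restrict S u)) * 𝟙 (genericOn M (∁ S) (restrict (∁ S) w)) * 𝟙 (listEqᵇ (zipWith _+_ (exponent S u) (exponent (∁ S) w)) β) ∎

listEqᵇ-punchIn : ∀ α β {k} (c : Fin (suc k) → ℕ) (i : Fin (suc k)) → toℕ i ≡ length α →
  listEqᵇ (map c (allFinL (suc k))) (α ++ 0 ∷ β) ≡ (c i ≡ᵇ 0) ∧ listEqᵇ (map (c ∘ punchIn i) (allFinL k)) (α ++ β)
listEqᵇ-punchIn []      β {k} c zero    refl = cong (λ cs → (c zero ≡ᵇ 0) ∧ listEqᵇ cs β) (sym (Listₚ.map-∘ (allFinL k)))
listEqᵇ-punchIn (a ∷ α) β {suc k} c (suc i) i≡α = begin
  (c zero ≡ᵇ a) ∧ listEqᵇ (map c (map suc (allFinL (suc k)))) (α ++ 0 ∷ β)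
    ≡⟨ cong (λ cs → (c zero ≡ᵇ a) ∧ listEqᵇ cs (α ++ 0 ∷ β)) (sym (Listₚ.map-∘ (allFinL (suc k)))) ⟩
  (c zero ≡ᵇ a) ∧ listEqᵇ (map (c ∘ suc) (allFinL (suc k))) (α ++ 0 ∷ β)
    ≡⟨ cong ((c zero ≡ᵇ a) ∧_) (listEqᵇ-punchIn α β (c ∘ suc) i (suc-injective i≡α)) ⟩
  (c zero ≡ᵇ a) ∧ ((c (suc i) ≡ᵇ 0) ∧ listEqᵇ (map (c ∘ suc ∘ punchIn i) (allFinL k)) (α ++ β))
    ≡⟨ ∧-CS.x∙yz≈y∙xz (c zero ≡ᵇ a) (c (suc i) ≡ᵇ 0) _ ⟩
  (c (suc i) ≡ᵇ 0) ∧ ((c zero ≡ᵇ a) ∧ listEqᵇ (map (c ∘ suc ∘ punchIn i) (allFinL k)) (α ++ β))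
    ≡⟨ cong (λ cs → (c (suc i) ≡ᵇ 0) ∧ ((c zero ≡ᵇ a) ∧ listEqᵇ cs (α ++ β))) (Listₚ.map-∘ (allFinL k)) ⟩
  (c (suc i) ≡ᵇ 0) ∧ ((c zero ≡ᵇ a) ∧ listEqᵇ (map (c ∘ punchIn (suc i)) (map suc (allFinL k))) (α ++ β)) ∎
  where open ≡-Reasoning

relabel : ∀ {n k} → Fin (suc k) → Vec (Maybe (Fin k)) n → Vec (Maybe (Fin (suc k))) n
relabel i = Vec.map (Maybe.map (punchIn i))

multiplicity-∷≡ᵇ0 : ∀ {n k} s (T : Subset n) (x : Maybe (Fin k)) v j →
  (multiplicity (s ∷ T) (x ∷ v) j ≡ᵇ 0) ≡ not (s ∧ hits x j) ∧ (multiplicity T v j ≡ᵇ 0)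
multiplicity-∷≡ᵇ0 {n} s T x v j
  rewrite countᵇ-map (λ e → lookup (s ∷ T) e ∧ hits (lookup (x ∷ v) e) j) suc (allFinL n) with s ∧ hits x j
... | true  = refl
... | false = refl

sumOver-skip : ∀ {k} (i : Fin (suc k)) (F : Fin (suc k) → ℕ) →
  sumOver (allFinL (suc k)) (λ j → 𝟙 (not (toℕ j ≡ᵇ toℕ i)) * F j) ≡ sumOver (allFinL k) (F ∘ punchIn i)
sumOver-skip {k} zero F =
  trans (sumOver-map (allFinL k) suc (λ j → 𝟙 (not (toℕ j ≡ᵇ 0)) * F j)) (sumOver-cong (allFinL k) λ j → +-identityʳ (F (suc j)))
sumOver-skip {suc k} (suc i) F = cong₂ _+_ (+-identityʳ (F zero)) (begin
  sumOver (map suc (allFinL (suc k))) (λ j → 𝟙 (not (toℕ j ≡ᵇ toℕ (suc i))) * F j)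
    ≡⟨ sumOver-map (allFinL (suc k)) suc _ ⟩
  sumOver (allFinL (suc k)) (λ j → 𝟙 (not (toℕ j ≡ᵇ toℕ i)) * F (suc j))
    ≡⟨ sumOver-skip i (F ∘ suc) ⟩
  sumOver (allFinL k) (F ∘ suc ∘ punchIn i)
    ≡⟨ sumOver-map (allFinL k) suc (F ∘ punchIn (suc i)) ⟨
  sumOver (map suc (allFinL k)) (F ∘ punchIn (suc i)) ∎)
  where open ≡-Reasoning

-- relabel i is a bijection from the maps into Fin k onto the maps into Fin (suc k) avoiding i.
sumOver-avoiding : ∀ {n k} (T : Subset n) (i : Fin (suc k)) (H : Vec (Maybe (Fin (suc k))) n → ℕ) →
  sumOver (partialFuns T (suc k)) (λ v → 𝟙 (multiplicity T v i ≡ᵇ 0) * H v) ≡ sumOver (partialFuns T k) (H ∘ relabel i)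
sumOver-avoiding []            i H = cong (_+ 0) (+-identityʳ (H []))
sumOver-avoiding {k = k} (inside ∷ T) i H = begin
  sumOver (partialFuns (inside ∷ T) (suc k)) (λ v → 𝟙 (multiplicity (inside ∷ T) v i ≡ᵇ 0) * H v)
    ≡⟨ sumOver-partialFuns-inside T (λ v → 𝟙 (multiplicity (inside ∷ T) v i ≡ᵇ 0) * H v) ⟩
  sumOver (partialFuns T (suc k)) (λ v → sumOver (allFinL (suc k)) λ j → 𝟙 (multiplicity (inside ∷ T) (just j ∷ v) i ≡ᵇ 0) * H (just j ∷ v))
    ≡⟨ sumOver-cong (partialFuns T (suc k)) (λ v → trans (sumOver-cong (allFinL (suc k)) (factor v))
         (sumOver-*ˡ (allFinL (suc k)) (𝟙 (multiplicity T v i ≡ᵇ 0)) (λ j → 𝟙 (not (toℕ j ≡ᵇ toℕ i)) * H (just j ∷ v)))) ⟩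
  sumOver (partialFuns T (suc k)) (λ v → 𝟙 (multiplicity T v i ≡ᵇ 0) * H′ v)
    ≡⟨ sumOver-avoiding T i H′ ⟩
  sumOver (partialFuns T k) (H′ ∘ relabel i)
    ≡⟨ sumOver-cong (partialFuns T k) (λ w → sumOver-skip i (λ j → H (just j ∷ relabel i w))) ⟩
  sumOver (partialFuns T k) (λ w → sumOver (allFinL k) λ j → H (relabel i (just j ∷ w)))
    ≡⟨ sumOver-partialFuns-inside T (H ∘ relabel i) ⟨
  sumOver (partialFuns (inside ∷ T) k) (H ∘ relabel i) ∎
  where
  open ≡-Reasoning
  H′ : Vec (Maybe (Fin (suc k))) _ → ℕ
  H′ v = sumOver (allFinL (suc k)) λ j → 𝟙 (not (toℕ j ≡ᵇ toℕ i)) * H (just j ∷ v)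
  factor : ∀ v j → 𝟙 (multiplicity (inside ∷ T) (just j ∷ v) i ≡ᵇ 0) * H (just j ∷ v) ≡
                   𝟙 (multiplicity T v i ≡ᵇ 0) * (𝟙 (not (toℕ j ≡ᵇ toℕ i)) * H (just j ∷ v))
  factor v j = begin
    𝟙 (multiplicity (inside ∷ T) (just j ∷ v) i ≡ᵇ 0) * H (just j ∷ v)
      ≡⟨ cong (λ b → 𝟙 b * H (just j ∷ v)) (multiplicity-∷≡ᵇ0 true T (just j) v i) ⟩
    𝟙 (not (toℕ j ≡ᵇ toℕ i) ∧ (multiplicity T v i ≡ᵇ 0)) * H (just j ∷ v)
      ≡⟨ cong (_* H (just j ∷ v)) (trans (𝟙-∧ (not (toℕ j ≡ᵇ toℕ i)) _) (*-comm (𝟙 (not (toℕ j ≡ᵇ toℕ i))) _)) ⟩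
    𝟙 (multiplicity T v i ≡ᵇ 0) * 𝟙 (not (toℕ j ≡ᵇ toℕ i)) * H (just j ∷ v)
      ≡⟨ *-assoc (𝟙 (multiplicity T v i ≡ᵇ 0)) _ _ ⟩
    𝟙 (multiplicity T v i ≡ᵇ 0) * (𝟙 (not (toℕ j ≡ᵇ toℕ i)) * H (just j ∷ v)) ∎
sumOver-avoiding (outside ∷ T) i H =
  trans (sumOver-partialFuns-outside T (λ v → 𝟙 (multiplicity (outside ∷ T) v i ≡ᵇ 0) * H v))
  (trans (sumOver-cong (partialFuns T _) λ v → cong (λ b → 𝟙 b * H (nothing ∷ v)) (multiplicity-∷≡ᵇ0 false T nothing v i))
  (trans (sumOver-avoiding T i (H ∘ (nothing ∷_)))
         (sym (sumOver-partialFuns-outside T (H ∘ relabel i)))))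

hits-relabel : ∀ {k} (i : Fin (suc k)) (x : Maybe (Fin k)) j → hits (Maybe.map (punchIn i) x) (punchIn i j) ≡ hits x j
hits-relabel i nothing  j = refl
hits-relabel i (just p) j = det (proof (toℕ (punchIn i p) ≟ toℕ (punchIn i j))) (proof (Dec.map (mk⇔ to from) (toℕ p ≟ toℕ j)))
  where
  to : toℕ p ≡ toℕ j → toℕ (punchIn i p) ≡ toℕ (punchIn i j)
  to = cong (toℕ ∘ punchIn i) ∘ Finₚ.toℕ-injective
  from : toℕ (punchIn i p) ≡ toℕ (punchIn i j) → toℕ p ≡ toℕ j
  from = cong toℕ ∘ Finₚ.punchIn-injective i p j ∘ Finₚ.toℕ-injective

multiplicity-relabel : ∀ {n k} (T : Subset n) (i : Fin (suc k)) (w : Vec (Maybe (Fin k)) n) j →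
  multiplicity T (relabel i w) (punchIn i j) ≡ multiplicity T w j
multiplicity-relabel {n} T i w j = countᵇ-cong (allFinL n) λ e →
  cong (lookup T e ∧_) (trans (cong (λ x → hits x (punchIn i j)) (Vecₚ.lookup-map e (Maybe.map (punchIn i)) w)) (hits-relabel i (lookup w e) j))

module _ {k} (i : Fin (suc k)) where

  masked-relabel-mono-≤ : ∀ s t (x y : Maybe (Fin k)) → masked s x ≤ masked t y →
    masked s (Maybe.map (punchIn i) x) ≤ masked t (Maybe.map (punchIn i) y)
  masked-relabel-mono-≤ false t        x        y        _         = z≤n
  masked-relabel-mono-≤ true  t        nothing  y        _         = z≤n
  masked-relabel-mono-≤ true  true     (just p) (just q) (s≤s p≤q) = s≤s (Finₚ.punchIn-mono-≤ i p q p≤q)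
  masked-relabel-mono-≤ true  false    (just p) y        ()
  masked-relabel-mono-≤ true  true     (just p) nothing  ()

  masked-relabel-cancel-≤ : ∀ s t (x y : Maybe (Fin k)) → masked s (Maybe.map (punchIn i) x) ≤ masked t (Maybe.map (punchIn i) y) →
    masked s x ≤ masked t y
  masked-relabel-cancel-≤ false t        x        y        _         = z≤n
  masked-relabel-cancel-≤ true  t        nothing  y        _         = z≤n
  masked-relabel-cancel-≤ true  true     (just p) (just q) (s≤s p≤q) = s≤s (Finₚ.punchIn-cancel-≤ i p q p≤q)
  masked-relabel-cancel-≤ true  false    (just p) y        ()
  masked-relabel-cancel-≤ true  true     (just p) nothing  ()

genericOn-relabel : ∀ {n k} (M : Matroid n) (T : Subset n) (i : Fin (suc k)) (w : Vec (Maybe (Fin k)) n) →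
  genericOn M T (restrict T (relabel i w)) ≡ genericOn M T (restrict T w)
genericOn-relabel M T i w = genericOn-transfer M T {restrict T (relabel i w)} {restrict T w}
  (λ {a} {b} → masked-relabel-cancel-≤ i (lookup T a) (lookup T b) (lookup w a) (lookup w b) ∘ subst₂ _≤_ (restrict-relabel a) (restrict-relabel b))
  (λ {a} {b} → subst₂ _≤_ (sym (restrict-relabel a)) (sym (restrict-relabel b)) ∘ masked-relabel-mono-≤ i (lookup T a) (lookup T b) (lookup w a) (lookup w b))
  where
  restrict-relabel : ∀ e → restrict T (relabel i w) e ≡ masked (lookup T e) (Maybe.map (punchIn i) (lookup w e))
  restrict-relabel e = cong (masked (lookup T e)) (Vecₚ.lookup-map e (Maybe.map (punchIn i)) w)

compress-invariant : ∀ (F : Series) → (∀ α β → F (α ++ 0 ∷ β) ≡ F (α ++ β)) → ∀ α β → F (α ++ β) ≡ F (α ++ compress β)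
compress-invariant F drop-zero α []          = refl
compress-invariant F drop-zero α (zero ∷ β)  = trans (drop-zero α β) (compress-invariant F drop-zero α β)
compress-invariant F drop-zero α (suc a ∷ β) = begin
  F (α ++ suc a ∷ β)                  ≡⟨ cong F (Listₚ.++-assoc α (suc a ∷ []) β) ⟨
  F ((α ++ suc a ∷ []) ++ β)          ≡⟨ compress-invariant F drop-zero (α ++ suc a ∷ []) β ⟩
  F ((α ++ suc a ∷ []) ++ compress β) ≡⟨ cong F (Listₚ.++-assoc α (suc a ∷ []) (compress β)) ⟩
  F (α ++ suc a ∷ compress β)         ∎
  where open ≡-Reasoning

module _ {n} (M : Matroid n) (T : Subset n) where

  FM-on-drop-zero : ∀ α β → FM-on M T (α ++ 0 ∷ β) ≡ FM-on M T (α ++ β)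
  FM-on-drop-zero α β = begin
    FM-on M T (α ++ 0 ∷ β)
      ≡⟨ cong (λ K → pos (countᵇ (contributes {k = K} M T (α ++ 0 ∷ β)) (partialFuns T K))) K≡suc-k ⟩
    pos (countᵇ (contributes M T (α ++ 0 ∷ β)) (partialFuns T (suc k)))
      ≡⟨ cong pos (countᵇ≡sumOver (contributes M T (α ++ 0 ∷ β)) (partialFuns T (suc k))) ⟩
    pos (sumOver (partialFuns T (suc k)) (𝟙 ∘ contributes M T (α ++ 0 ∷ β)))
      ≡⟨ cong pos (sumOver-cong (partialFuns T (suc k)) split) ⟩
    pos (sumOver (partialFuns T (suc k)) λ v → 𝟙 (multiplicity T v i ≡ᵇ 0) * H v)
      ≡⟨ cong pos (sumOver-avoiding T i H) ⟩
    pos (sumOver (partialFuns T k) (H ∘ relabel i))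
      ≡⟨ cong pos (sumOver-cong (partialFuns T k) λ w → cong 𝟙 (cong₂ (λ g e → g ∧ listEqᵇ e (α ++ β))
           (genericOn-relabel M T i w) (Listₚ.map-cong (multiplicity-relabel T i w) (allFinL k)))) ⟩
    pos (sumOver (partialFuns T k) (𝟙 ∘ contributes M T (α ++ β)))
      ≡⟨ cong pos (countᵇ≡sumOver (contributes M T (α ++ β)) (partialFuns T k)) ⟨
    FM-on M T (α ++ β) ∎
    where
    open ≡-Reasoning
    k = length (α ++ β)
    K≡suc-k : length (α ++ 0 ∷ β) ≡ suc k
    K≡suc-k = trans (Listₚ.length-++ α) (trans (+-suc (length α) (length β)) (cong suc (sym (Listₚ.length-++ α))))
    α≤k : length α ≤ k
    α≤k = subst (length α ≤_) (sym (Listₚ.length-++ α)) (m≤m+n (length α) (length β))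
    i : Fin (suc k)
    i = Fin.fromℕ< (s≤s α≤k)
    H : Vec (Maybe (Fin (suc k))) n → ℕ
    H v = 𝟙 (genericOn M T (restrict T v) ∧ listEqᵇ (map (multiplicity T v ∘ punchIn i) (allFinL k)) (α ++ β))
    split : ∀ v → 𝟙 (contributes M T (α ++ 0 ∷ β) v) ≡ 𝟙 (multiplicity T v i ≡ᵇ 0) * H v
    split v = begin
      𝟙 (genericOn M T (restrict T v) ∧ listEqᵇ (exponent T v) (α ++ 0 ∷ β))
        ≡⟨ cong (λ b → 𝟙 (genericOn M T (restrict T v) ∧ b)) (listEqᵇ-punchIn α β (multiplicity T v) i (Finₚ.toℕ-fromℕ< (s≤s α≤k))) ⟩
      𝟙 (genericOn M T (restrict T v) ∧ ((multiplicity T v i ≡ᵇ 0) ∧ listEqᵇ (map (multiplicity T v ∘ punchIn i) (allFinL k)) (α ++ β)))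
        ≡⟨ cong 𝟙 (∧-CS.x∙yz≈y∙xz (genericOn M T (restrict T v)) (multiplicity T v i ≡ᵇ 0) _) ⟩
      𝟙 ((multiplicity T v i ≡ᵇ 0) ∧ (genericOn M T (restrict T v) ∧ listEqᵇ (map (multiplicity T v ∘ punchIn i) (allFinL k)) (α ++ β)))
        ≡⟨ 𝟙-∧ (multiplicity T v i ≡ᵇ 0) _ ⟩
      𝟙 (multiplicity T v i ≡ᵇ 0) * H v ∎

  exponent-degree : ∀ {k} (v : Vec (Maybe (Fin k)) n) → expSum (exponent T v) ≤ n
  exponent-degree {k} v = begin
    expSum (exponent T v)
      ≡⟨ expSum-map (multiplicity T v) (allFinL k) ⟩
    sumOver (allFinL k) (multiplicity T v)
      ≡⟨ sumOver-cong (allFinL k) (λ j → countᵇ≡sumOver (λ e → lookup T e ∧ hits (lookup v e) j) (allFinL n)) ⟩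
    sumOver (allFinL k) (λ j → sumOver (allFinL n) λ e → 𝟙 (lookup T e ∧ hits (lookup v e) j))
      ≡⟨ sumOver-comm (allFinL k) (allFinL n) (λ j e → 𝟙 (lookup T e ∧ hits (lookup v e) j)) ⟩
    sumOver (allFinL n) (λ e → sumOver (allFinL k) λ j → 𝟙 (lookup T e ∧ hits (lookup v e) j))
      ≤⟨ sumOver-mono (allFinL n) (λ e → at-most-one (lookup T e) (lookup v e)) ⟩
    sumOver (allFinL n) (λ _ → 1)
      ≡⟨ trans (sumOver-const-1 (allFinL n)) (length-allFinL n) ⟩
    n ∎
    where
    open ≤-Reasoning
    at-most-one : ∀ s x → sumOver (allFinL k) (λ j → 𝟙 (s ∧ hits x j)) ≤ 1
    at-most-one false x        = ≤-trans (≤-reflexive (sumOver-zero (allFinL k))) z≤n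
    at-most-one true  nothing  = ≤-trans (≤-reflexive (sumOver-zero (allFinL k))) z≤n
    at-most-one true  (just p) = at-most-one-hit p
      where
      at-most-one-hit : ∀ {k} (p : Fin k) → sumOver (allFinL k) (λ j → 𝟙 (toℕ p ≡ᵇ toℕ j)) ≤ 1
      at-most-one-hit {suc b} p = begin
        sumOver (allFinL (suc b)) (λ j → 𝟙 (toℕ p ≡ᵇ toℕ j))
          ≡⟨ sumOver-allFinL {suc b} (λ j → 𝟙 (toℕ p ≡ᵇ toℕ j)) ⟩
        sumFinℕ {suc b} (λ j → 𝟙 (toℕ p ≡ᵇ toℕ j))
          ≡⟨ sumFinℕ-cong {suc b} (λ j → *-identityʳ (𝟙 (toℕ p ≡ᵇ toℕ j))) ⟨
        sumFinℕ {suc b} (λ j → 𝟙 (toℕ p ≡ᵇ toℕ j) * 1)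
          ≡⟨ sumFin-indicator b (toℕ p) (λ _ → 1) ⟩
        (if toℕ p ≤ᵇ b then 1 else 0)
          ≤⟨ 𝟙≤1 (toℕ p ≤ᵇ b) ⟩
        1 ∎
        where
        𝟙≤1 : ∀ c → 𝟙 c ≤ 1
        𝟙≤1 true  = ≤-refl
        𝟙≤1 false = z≤n

  FM-on-bounded : ∀ β → n < expSum β → FM-on M T β ≡ pos 0
  FM-on-bounded β n<β = cong pos (countᵇ≡0⇐ (contributes M T β) {partialFuns T (length β)} λ {v} _ contributes-v →
    <⇒≱ n<β (subst (λ γ → expSum γ ≤ n)
                   (listEqᵇ⇒≡ (exponent T v) β (proj₂ (Boolₚ.T-∧ {genericOn M T (restrict T v)} .Equivalence.to contributes-v)))
                   (exponent-degree v)))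

concatMap-nil : ∀ {A B : Set} (xs : List A) → concatMap {B = B} (λ _ → []) xs ≡ []
concatMap-nil []       = refl
concatMap-nil (x ∷ xs) = concatMap-nil xs

partialFuns-empty : ∀ {n} (T : Subset n) {e} → lookup T e ≡ true → partialFuns T 0 ≡ []
partialFuns-empty (inside ∷ T)  _               = concatMap-nil (partialFuns T 0)
partialFuns-empty (outside ∷ T) {suc e} e∈T = cong (List.map _) (partialFuns-empty T e∈T)

FM-on-constant : ∀ {n} (M : Matroid n) (T : Subset n) {e} → lookup T e ≡ true → FM-on M T [] ≡ pos 0
FM-on-constant M T e∈T = cong (λ fs → pos (countᵇ (contributes M T []) fs)) (partialFuns-empty T e∈T)

FM-on-QSym : ∀ {n} → Matroid n → Subset n → QSym
FM-on-QSym {n} M T = record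
  { coeff      = FM-on M T
  ; quasisym   = compress-invariant (FM-on M T) (FM-on-drop-zero M T) []
  ; boundedDeg = n , FM-on-bounded M T }

corollary7p6 : (m : ℕ) (M : Matroid (suc m)) → ¬ DimAtLeast M m → InMaxIdealSq (FM M)
corollary7p6 m M low-dimension with nontrivial-separator M low-dimension
... | S , separator , (e , e∈S) , (e′ , e′∉S) =
  (FM-on-QSym M S , FM-on-QSym M (∁ S)) ∷ [] ,
  (FM-on-constant M S e∈S , FM-on-constant M (∁ S) (trans (lookup-∁ S e′) (cong not e′∉S))) ∷ [] ,
  λ β → trans (FM-factorizes M {S} separator β) (sym (ℤₚ.+-identityʳ _))
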